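{- Let $G$ be a finite $k$-regular graph (loopless, possibly with multiple edges). Then $\check{s}(G)=3$ if and only if $G$ is Class 2 and, for some integer $r$ with $0\le r<k$, $G$ can be decomposed into three Class 1 $\frac{k-r}{2}$-regular subgraphs together with, if $r>0$, a Class 1 $r$-regular spanning subgraph.
   Context: A $k$-edge-coloring of $G$ is a map $c\colon E(G)\to\{1,\dots,k\}$ such that any two distinct edges sharing an endpoint receive different colors. The palette of a vertex $v$ with respect to $c$ is $P_c(v)=\{c(e): e \text{ incident with } v\}$. The palette index $\check{s}(G)$ is the minimum, over all edge-colorings $c$ of $G$ (with any number of colors), of the number of distinct palettes $P_c(v)$, $v\in V(G)$. A graph with maximum degree $\Delta$ is Class 1 if it admits a $\Delta$-edge-coloring, and Class 2 otherwise. A decomposition of $G$ is a family of subgraphs of $G$, each with nonempty edge set, whose edge sets are pairwise disjoint and have union $E(G)$. A subgraph is spanning if its vertex set is $V(G)$. -}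

module Defs where

open import Data.Nat using (ℕ; zero; suc; _+_; _*_; _≤_; _<_; _⊔_)
open import Data.Fin using (Fin; _≟_; inject₁; fromℕ)
open import Data.Bool using (Bool; true; false; _∨_; if_then_else_)
open import Data.List using (List; foldr; map)
open import Data.Nat.ListAction using (sum)
open import Data.List.Base using (allFin)
open import Data.Product using (Σ; ∃; _×_; _,_)
open import Data.Sum using (_⊎_)
open import Relation.Nullary using (¬_; does)
open import Relation.Binary.PropositionalEquality using (_≡_; _≢_)
open import Function.Definitions using (Injective; Surjective)

record Graph : Set where
  field
    n : ℕ
    m : ℕ
    src : Fin m → Fin n
    tgt : Fin m → Fin n
    loopless : ∀ e → src e ≢ tgt e
open Graph public

module _ (G : Graph) where

  Inc : Fin (m G) → Fin (n G) → Set
  Inc e v = src G e ≡ v ⊎ tgt G e ≡ v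

  incB : Fin (m G) → Fin (n G) → Bool
  incB e v = does (src G e ≟ v) ∨ does (tgt G e ≟ v)

  degree : Fin (n G) → ℕ
  degree v = sum (map (λ e → if incB e v then 1 else 0) (allFin (m G)))

  maxDegree : ℕ
  maxDegree = foldr _⊔_ 0 (map degree (allFin (n G)))

  Regular : ℕ → Set
  Regular k = ∀ v → degree v ≡ k

  Coloring : Set
  Coloring = Fin (m G) → ℕ

  Adjacent : Fin (m G) → Fin (m G) → Set
  Adjacent e e′ = ∃ λ v → Inc e v × Inc e′ v

  Proper : Coloring → Set
  Proper c = ∀ e e′ → e ≢ e′ → Adjacent e e′ → c e ≢ c e′

  KEdgeColorable : ℕ → Set
  KEdgeColorable k = Σ Coloring λ c → Proper c × (∀ e → c e < k)

  Class1 : Set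
  Class1 = KEdgeColorable maxDegree

  Class2 : Set
  Class2 = ¬ Class1

  InPalette : Coloring → Fin (n G) → ℕ → Set
  InPalette c v col = ∃ λ e → Inc e v × c e ≡ col

  SamePalette : Coloring → Fin (n G) → Fin (n G) → Set
  SamePalette c v w = ∀ col → (InPalette c v col → InPalette c w col)
                             × (InPalette c w col → InPalette c v col)

  -- the palettes of c take exactly t distinct values:
  -- there is a surjective labelling of vertices by Fin t whose fibres
  -- are exactly the classes of equal palettes
  NumPalettes : Coloring → ℕ → Set
  NumPalettes c t = Σ (Fin (n G) → Fin t) λ f → Surjective _≡_ _≡_ f
    × (∀ v w → (f v ≡ f w → SamePalette c v w) × (SamePalette c v w → f v ≡ f w))

  PaletteIndex : ℕ → Set
  PaletteIndex s = (Σ Coloring λ c → Proper c × NumPalettes c s)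
    × (∀ c → Proper c → ∀ t → NumPalettes c t → s ≤ t)

record Subgraph (G : Graph) : Set where
  field
    H : Graph
    vmap : Fin (n H) → Fin (n G)
    emap : Fin (m H) → Fin (m G)
    vinj : Injective _≡_ _≡_ vmap
    einj : Injective _≡_ _≡_ emap
    src-pres : ∀ e → src G (emap e) ≡ vmap (src H e)
    tgt-pres : ∀ e → tgt G (emap e) ≡ vmap (tgt H e)
open Subgraph public

Spanning : {G : Graph} → Subgraph G → Set
Spanning S = Surjective _≡_ _≡_ (vmap S)

Decomposition : (G : Graph) (t : ℕ) → (Fin t → Subgraph G) → Set
Decomposition G t F =
    (∀ i → 1 ≤ m (H (F i)))
  × (∀ i j (e : Fin (m (H (F i)))) (e′ : Fin (m (H (F j))))
       → emap (F i) e ≡ emap (F j) e′ → i ≡ j)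
  × (∀ (e : Fin (m G)) → ∃ λ i → ∃ λ (e′ : Fin (m (H (F i)))) → emap (F i) e′ ≡ e)

DecompCondition : Graph → ℕ → ℕ → Set
DecompCondition G k r = Σ ℕ λ d → 2 * d + r ≡ k ×
  ( (r ≡ 0 × Σ (Fin 3 → Subgraph G) λ F → Decomposition G 3 F
        × (∀ i → Regular (H (F i)) d × Class1 (H (F i))))
  ⊎ (1 ≤ r × Σ (Fin 4 → Subgraph G) λ F → Decomposition G 4 F
        × (∀ (i : Fin 3) → Regular (H (F (inject₁ i))) d × Class1 (H (F (inject₁ i))))
        × Spanning (F (fromℕ 3)) × Regular (H (F (fromℕ 3))) r × Class1 (H (F (fromℕ 3)))))

-- If a Class 2 k-regular graph has a colouring with three palettes, classify every colour by the
-- set of palettes containing it.  Counting each palette shows that #only i + #allBut j is symmetric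
-- in i and j, so #only i = m₀ + a i and #allBut i = a i + d.  The d highest colours of kind
-- "all but the i-th palette" then span a d-regular Class 1 subgraph, and the remaining colours,
-- repacked into r = k - 2d colours, an r-regular Class 1 spanning subgraph; d ≥ 1 as G is Class 2.
-- Conversely, colouring the parts of such a decomposition with disjoint intervals of colours makes
-- the palette of a vertex depend only on the d-regular part it misses, so there are three palettes.
-- At least three are needed: a Class 1 regular graph has palette index 1, and with two palettes the
-- colours of each palette can be renumbered into [0, k), giving a k-edge-colouring.

module Submission where

open import Defs
open import Algebra.Properties.CommutativeSemigroup using (interchange)
open import Data.Bool using (Bool; true; false; _∨_; _∧_; if_then_else_; not; T)
open import Data.Bool.Properties using (∧-identityʳ; ∧-zeroʳ; ∧-conicalˡ; ∧-conicalʳ; T-≡) renaming (_≟_ to _≟𝔹_)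
open import Data.Empty using (⊥; ⊥-elim)
open import Data.Fin using (Fin; zero; suc; toℕ; inject₁; fromℕ; fromℕ<; punchOut; _≟_)
open import Data.Fin.Properties using (any?; suc-injective; toℕ-injective; toℕ<n; fromℕ<-toℕ; injective⇒≤; punchOut-injective)
open import Data.List using (map; tabulate; allFin; foldr)
open import Data.List.Properties using (map-tabulate)
open import Data.Nat using (ℕ; zero; suc; _+_; _*_; _∸_; _≤_; _<_; _⊔_; _⊓_; z≤n; s≤s; _≡ᵇ_; _<ᵇ_; _≤ᵇ_; _<?_)
open import Data.Nat.ListAction using (sum)
open import Data.Nat.Properties hiding (_≟_; suc-injective)
open import Data.Nat.Tactic.RingSolver using (solve-∀)
open import Data.Product using (Σ; ∃; _×_; _,_; proj₁; proj₂)
open import Data.Sum using (_⊎_; inj₁; inj₂; [_,_]′)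
open import Function using (_∘_; Equivalence)
open import Function.Definitions using (Injective; Surjective)
open import Relation.Binary.Definitions using (tri<; tri≈; tri>)
open import Relation.Binary.PropositionalEquality
open import Relation.Nullary using (¬_; does; yes; no; Dec)
open import Relation.Nullary.Decidable using (¬?; _×-dec_)

true≢false : true ≢ false
true≢false ()

𝟙 : Bool → ℕ
𝟙 b = if b then 1 else 0

∧-projˡ : ∀ {a b} → a ∧ b ≡ true → a ≡ true
∧-projˡ {a} {b} = ∧-conicalˡ a b

∧-projʳ : ∀ {a b} → a ∧ b ≡ true → b ≡ true
∧-projʳ {a} {b} = ∧-conicalʳ a b

∧-intro : ∀ {a b} → a ≡ true → b ≡ true → a ∧ b ≡ true
∧-intro refl refl = refl

not≡true⇒≡false : ∀ {b} → not b ≡ true → b ≡ false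
not≡true⇒≡false {false} _ = refl

≢true⇒≡false : ∀ {b} → b ≢ true → b ≡ false
≢true⇒≡false {true} h = ⊥-elim (h refl)
≢true⇒≡false {false} _ = refl

Bool-ext : ∀ {a b} → (a ≡ true → b ≡ true) → (b ≡ true → a ≡ true) → a ≡ b
Bool-ext {true} {true} _ _ = refl
Bool-ext {true} {false} f _ = sym (f refl)
Bool-ext {false} {true} _ g = g refl
Bool-ext {false} {false} _ _ = refl

bool-cases : ∀ {A : Set} b → (b ≡ true → A) → (b ≡ false → A) → A
bool-cases true f _ = f refl
bool-cases false _ g = g refl

if-true : ∀ {A : Set} {b} {u v : A} → b ≡ true → (if b then u else v) ≡ u
if-true refl = refl

if-false : ∀ {A : Set} {b} {u v : A} → b ≡ false → (if b then u else v) ≡ v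
if-false refl = refl

T⇒≡true : ∀ {b} → T b → b ≡ true
T⇒≡true = Equivalence.to T-≡

≡true⇒T : ∀ {b} → b ≡ true → T b
≡true⇒T = Equivalence.from T-≡

≡ᵇ-true⇒≡ : ∀ {x y} → (x ≡ᵇ y) ≡ true → x ≡ y
≡ᵇ-true⇒≡ {x} {y} h = ≡ᵇ⇒≡ x y (≡true⇒T h)

≡ᵇ-refl : ∀ x → (x ≡ᵇ x) ≡ true
≡ᵇ-refl x = T⇒≡true (≡⇒≡ᵇ x x refl)

<⇒<ᵇ-true : ∀ {x y} → x < y → (x <ᵇ y) ≡ true
<⇒<ᵇ-true p = T⇒≡true (<⇒<ᵇ p)

<ᵇ-true⇒< : ∀ {x y} → (x <ᵇ y) ≡ true → x < y
<ᵇ-true⇒< {x} {y} h = <ᵇ⇒< x y (≡true⇒T h)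

≮⇒<ᵇ-false : ∀ {x y} → ¬ x < y → (x <ᵇ y) ≡ false
≮⇒<ᵇ-false h = ≢true⇒≡false (h ∘ <ᵇ-true⇒<)

<ᵇ-false⇒≥ : ∀ {x y} → (x <ᵇ y) ≡ false → y ≤ x
<ᵇ-false⇒≥ h = ≮⇒≥ (λ l → true≢false (trans (sym (<⇒<ᵇ-true l)) h))

≤⇒≤ᵇ-true : ∀ {x y} → x ≤ y → (x ≤ᵇ y) ≡ true
≤⇒≤ᵇ-true p = T⇒≡true (≤⇒≤ᵇ p)

≤ᵇ-true⇒≤ : ∀ {x y} → (x ≤ᵇ y) ≡ true → x ≤ y
≤ᵇ-true⇒≤ {x} {y} h = ≤ᵇ⇒≤ x y (≡true⇒T h)

eqᶠ : ∀ {k} → Fin k → Fin k → Bool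
eqᶠ i j = does (i ≟ j)

eqᶠ-refl : ∀ {k} (i : Fin k) → eqᶠ i i ≡ true
eqᶠ-refl i with i ≟ i
... | yes _ = refl
... | no h = ⊥-elim (h refl)

eqᶠ-true⇒≡ : ∀ {k} {i j : Fin k} → eqᶠ i j ≡ true → i ≡ j
eqᶠ-true⇒≡ {i = i} {j} h with i ≟ j
... | yes p = p

sumFin : ∀ m → (Fin m → ℕ) → ℕ
sumFin zero f = 0
sumFin (suc m) f = f zero + sumFin m (f ∘ suc)

anyFin : ∀ m → (Fin m → Bool) → Bool
anyFin zero p = false
anyFin (suc m) p = p zero ∨ anyFin m (p ∘ suc)

sum-tabulate : ∀ n (g : Fin n → ℕ) → sum (tabulate g) ≡ sumFin n g
sum-tabulate zero g = refl
sum-tabulate (suc n) g = cong (g zero +_) (sum-tabulate n (g ∘ suc))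

sum-map-allFin : ∀ n (h : Fin n → ℕ) → sum (map h (allFin n)) ≡ sumFin n h
sum-map-allFin n h = trans (cong sum (map-tabulate (λ e → e) h)) (sum-tabulate n h)

sumFin-cong : ∀ m {f g : Fin m → ℕ} → (∀ e → f e ≡ g e) → sumFin m f ≡ sumFin m g
sumFin-cong zero eq = refl
sumFin-cong (suc m) eq = cong₂ _+_ (eq zero) (sumFin-cong m (eq ∘ suc))

sumFin-distrib-+ : ∀ m (f g : Fin m → ℕ) → sumFin m (λ e → f e + g e) ≡ sumFin m f + sumFin m g
sumFin-distrib-+ zero f g = refl
sumFin-distrib-+ (suc m) f g =
  trans (cong (f zero + g zero +_) (sumFin-distrib-+ m _ _)) (interchange +-commutativeSemigroup (f zero) (g zero) _ _)

sumFin-zero : ∀ m (f : Fin m → ℕ) → (∀ e → f e ≡ 0) → sumFin m f ≡ 0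
sumFin-zero zero f h = refl
sumFin-zero (suc m) f h = cong₂ _+_ (h zero) (sumFin-zero m _ (h ∘ suc))

sumFin-positive⇒nonempty : ∀ m (f : Fin m → ℕ) → 1 ≤ sumFin m f → 1 ≤ m
sumFin-positive⇒nonempty (suc m) f h = s≤s z≤n

≤-sumFin : ∀ m (f : Fin m → ℕ) e → f e ≤ sumFin m f
≤-sumFin (suc m) f zero = m≤m+n _ _
≤-sumFin (suc m) f (suc e) = ≤-trans (≤-sumFin m _ e) (m≤n+m _ _)

anyFin-sound : ∀ m p → anyFin m p ≡ true → ∃ λ e → p e ≡ true
anyFin-sound (suc m) p h with p zero in eq
... | true = zero , eq
... | false = let (e , q) = anyFin-sound m _ h in suc e , q

anyFin-complete : ∀ m p e → p e ≡ true → anyFin m p ≡ true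
anyFin-complete (suc m) p zero h rewrite h = refl
anyFin-complete (suc m) p (suc e) h with p zero
... | true = refl
... | false = anyFin-complete m _ e h

anyFin-cong : ∀ m {p q : Fin m → Bool} → (∀ i → p i ≡ q i) → anyFin m p ≡ anyFin m q
anyFin-cong zero h = refl
anyFin-cong (suc m) h = cong₂ _∨_ (h zero) (anyFin-cong m (h ∘ suc))

sumFin-𝟙-unique : ∀ m (p : Fin m → Bool) → (∀ e e′ → p e ≡ true → p e′ ≡ true → e ≡ e′)
  → sumFin m (𝟙 ∘ p) ≡ 𝟙 (anyFin m p)
sumFin-𝟙-unique zero p u = refl
sumFin-𝟙-unique (suc m) p u with p zero in eq
... | true = cong suc (sumFin-zero m _ others-false)
  where
  others-false : ∀ e → 𝟙 (p (suc e)) ≡ 0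
  others-false e with p (suc e) in eq′
  ... | true with () ← u zero (suc e) eq eq′
  ... | false = refl
... | false = sumFin-𝟙-unique m _ (λ e e′ a b → suc-injective (u (suc e) (suc e′) a b))

sumBelow : (ℕ → ℕ) → ℕ → ℕ
sumBelow f zero = 0
sumBelow f (suc N) = sumBelow f N + f N

countBelow : (ℕ → Bool) → ℕ → ℕ
countBelow p = sumBelow (𝟙 ∘ p)

sumBelow-cong : ∀ N {f g : ℕ → ℕ} → (∀ x → x < N → f x ≡ g x) → sumBelow f N ≡ sumBelow g N
sumBelow-cong zero h = refl
sumBelow-cong (suc N) h = cong₂ _+_ (sumBelow-cong N (λ x p → h x (m<n⇒m<1+n p))) (h N (n<1+n N))

sumBelow-distrib-+ : ∀ N (f g : ℕ → ℕ) → sumBelow (λ x → f x + g x) N ≡ sumBelow f N + sumBelow g N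
sumBelow-distrib-+ zero f g = refl
sumBelow-distrib-+ (suc N) f g =
  trans (cong (_+ (f N + g N)) (sumBelow-distrib-+ N f g)) (interchange +-commutativeSemigroup (sumBelow f N) (sumBelow g N) (f N) (g N))

sumBelow-mono : ∀ (f : ℕ → ℕ) a b → a ≤ b → sumBelow f a ≤ sumBelow f b
sumBelow-mono f a zero z≤n = z≤n
sumBelow-mono f a (suc b) l with m≤n⇒m<n∨m≡n l
... | inj₂ refl = ≤-refl
... | inj₁ l′ = ≤-trans (sumBelow-mono f a b (≤-pred l′)) (m≤m+n _ _)

sumBelow-sumFin : ∀ N t (g : ℕ → Fin t → ℕ) → sumBelow (λ x → sumFin t (g x)) N ≡ sumFin t (λ i → sumBelow (λ x → g x i) N)
sumBelow-sumFin zero t g = sym (sumFin-zero t _ (λ _ → refl))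
sumBelow-sumFin (suc N) t g = trans (cong (_+ sumFin t (g N)) (sumBelow-sumFin N t g)) (sym (sumFin-distrib-+ t _ _))

countBelow-cong : ∀ N {p q : ℕ → Bool} → (∀ x → x < N → p x ≡ q x) → countBelow p N ≡ countBelow q N
countBelow-cong N h = sumBelow-cong N (λ x l → cong 𝟙 (h x l))

countBelow-split : ∀ N (p q r : ℕ → Bool) → (∀ x → 𝟙 (p x) ≡ 𝟙 (q x) + 𝟙 (r x))
  → countBelow p N ≡ countBelow q N + countBelow r N
countBelow-split N p q r h = trans (sumBelow-cong N (λ x _ → h x)) (sumBelow-distrib-+ N _ _)

countBelow-split₄ : ∀ N (p q₁ q₂ q₃ q₄ : ℕ → Bool) → (∀ x → 𝟙 (p x) ≡ 𝟙 (q₁ x) + 𝟙 (q₂ x) + 𝟙 (q₃ x) + 𝟙 (q₄ x))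
  → countBelow p N ≡ countBelow q₁ N + countBelow q₂ N + countBelow q₃ N + countBelow q₄ N
countBelow-split₄ N p q₁ q₂ q₃ q₄ h = trans (sumBelow-cong N (λ x _ → h x))
  (trans (sumBelow-distrib-+ N _ _) (cong (_+ countBelow q₄ N)
    (trans (sumBelow-distrib-+ N _ _) (cong (_+ countBelow q₃ N) (sumBelow-distrib-+ N _ _)))))

𝟙≤1 : ∀ b → 𝟙 b ≤ 1
𝟙≤1 true = ≤-refl
𝟙≤1 false = z≤n

countBelow≤ : ∀ p N → countBelow p N ≤ N
countBelow≤ p zero = z≤n
countBelow≤ p (suc N) = subst (countBelow p N + 𝟙 (p N) ≤_) (+-comm N 1) (+-mono-≤ (countBelow≤ p N) (𝟙≤1 (p N)))

countBelow-full : ∀ p N → countBelow p N ≡ N → ∀ x → x < N → p x ≡ true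
countBelow-full p (suc N) h x l with p N in eq
... | false = ⊥-elim (<⇒≱ (n<1+n N) (subst (_≤ N) (trans (sym (+-identityʳ _)) h) (countBelow≤ p N)))
... | true with m<1+n⇒m<n∨m≡n l
... | inj₂ refl = eq
... | inj₁ l′ = countBelow-full p N (+-cancelʳ-≡ _ _ _ (trans h (+-comm 1 N))) x l′

countBelow-zero : ∀ p N → countBelow p N ≡ 0 → ∀ x → x < N → p x ≡ false
countBelow-zero p (suc N) h x l with p N in eq
... | true = ⊥-elim (1+n≢0 (trans (+-comm 1 _) h))
... | false with m<1+n⇒m<n∨m≡n l
... | inj₂ refl = eq
... | inj₁ l′ = countBelow-zero p N (trans (sym (+-identityʳ _)) h) x l′

countBelow-all : ∀ p N → (∀ x → x < N → p x ≡ true) → countBelow p N ≡ N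
countBelow-all p zero h = refl
countBelow-all p (suc N) h =
  trans (cong₂ _+_ (countBelow-all p N (λ x l → h x (m<n⇒m<1+n l))) (cong 𝟙 (h N (n<1+n N)))) (+-comm N 1)

countBelow-none : ∀ p N → (∀ x → x < N → p x ≡ false) → countBelow p N ≡ 0
countBelow-none p zero h = refl
countBelow-none p (suc N) h = cong₂ _+_ (countBelow-none p N (λ x l → h x (m<n⇒m<1+n l))) (cong 𝟙 (h N (n<1+n N)))

countBelow-+ : ∀ p a b → countBelow p (a + b) ≡ countBelow p a + countBelow (λ y → p (a + y)) b
countBelow-+ p a zero = trans (cong (countBelow p) (+-identityʳ a)) (sym (+-identityʳ _))
countBelow-+ p a (suc b) = trans (cong (countBelow p) (+-suc a b))
  (trans (cong (_+ 𝟙 (p (a + b))) (countBelow-+ p a b)) (+-assoc (countBelow p a) _ _))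

rank : (ℕ → Bool) → ℕ → ℕ
rank = countBelow

countBelow-mono : ∀ p a b → a ≤ b → countBelow p a ≤ countBelow p b
countBelow-mono p = sumBelow-mono (𝟙 ∘ p)

rank-< : ∀ p x y → p x ≡ true → x < y → rank p x < countBelow p y
rank-< p x y h l = ≤-trans (subst (_≤ countBelow p (suc x)) (trans (cong (rank p x +_) (cong 𝟙 h)) (+-comm (rank p x) 1)) ≤-refl)
                           (countBelow-mono p (suc x) y l)

rank-injective : ∀ p x y → p x ≡ true → p y ≡ true → rank p x ≡ rank p y → x ≡ y
rank-injective p x y hx hy e with <-cmp x y
... | tri≈ _ q _ = q
... | tri< l _ _ = ⊥-elim (<⇒≢ (rank-< p x y hx l) e)
... | tri> _ _ l = ⊥-elim (<⇒≢ (rank-< p y x hy l) (sym e))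

countBelow-rank< : ∀ p a N → countBelow (λ x → p x ∧ (rank p x <ᵇ a)) N ≡ countBelow p N ⊓ a
countBelow-rank< p a zero = refl
countBelow-rank< p a (suc N) with p N
... | true = trans (cong (_+ 𝟙 (rank p N <ᵇ a)) (countBelow-rank< p a N)) (⊓-+-𝟙<ᵇ (countBelow p N) a)
  where
  ⊓-+-𝟙<ᵇ : ∀ c a → (c ⊓ a) + 𝟙 (c <ᵇ a) ≡ (c + 1) ⊓ a
  ⊓-+-𝟙<ᵇ zero zero = refl
  ⊓-+-𝟙<ᵇ zero (suc a) = refl
  ⊓-+-𝟙<ᵇ (suc c) zero = refl
  ⊓-+-𝟙<ᵇ (suc c) (suc a) = cong suc (⊓-+-𝟙<ᵇ c a)
... | false = trans (+-identityʳ _) (trans (countBelow-rank< p a N) (cong (_⊓ a) (sym (+-identityʳ _))))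

countBelow-rank≥ : ∀ p a N → countBelow (λ x → p x ∧ not (rank p x <ᵇ a)) N ≡ countBelow p N ∸ a
countBelow-rank≥ p a N = +-cancelˡ-≡ low _ _ (begin
  low + high                                ≡⟨ sym total ⟩
  countBelow p N                            ≡⟨ sym (m⊓n+n∸m≡n a (countBelow p N)) ⟩
  a ⊓ countBelow p N + (countBelow p N ∸ a) ≡⟨ cong (_+ (countBelow p N ∸ a)) (trans (⊓-comm a _) (sym (countBelow-rank< p a N))) ⟩
  low + (countBelow p N ∸ a)                ∎)
  where
  open ≡-Reasoning
  low high : ℕ
  low = countBelow (λ x → p x ∧ (rank p x <ᵇ a)) N
  high = countBelow (λ x → p x ∧ not (rank p x <ᵇ a)) N
  total : countBelow p N ≡ low + high
  total = countBelow-split N p _ _ λ x → split (p x) (rank p x <ᵇ a)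
    where
    split : ∀ b c → 𝟙 b ≡ 𝟙 (b ∧ c) + 𝟙 (b ∧ not c)
    split true true = refl
    split true false = refl
    split false _ = refl

inInterval : ℕ → ℕ → ℕ → Bool
inInterval lo s x = (lo ≤ᵇ x) ∧ (x <ᵇ lo + s)

inInterval-+ : ∀ lo s y → y < s → inInterval lo s (lo + y) ≡ true
inInterval-+ lo s y l = ∧-intro (≤⇒≤ᵇ-true (m≤m+n lo y)) (<⇒<ᵇ-true (+-monoʳ-< lo l))

inInterval-offset : ∀ lo s x → inInterval lo s x ≡ true → lo + (x ∸ lo) ≡ x × x ∸ lo < s
inInterval-offset lo s x h =
  m+[n∸m]≡n lo≤x , +-cancelˡ-< lo _ _ (subst (_< lo + s) (sym (m+[n∸m]≡n lo≤x)) (<ᵇ-true⇒< (∧-projʳ {lo ≤ᵇ x} h)))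
  where
  lo≤x : lo ≤ x
  lo≤x = ≤ᵇ-true⇒≤ (∧-projˡ h)

countBelow-inInterval : ∀ lo s N → lo + s ≤ N → countBelow (inInterval lo s) N ≡ s
countBelow-inInterval lo s N le = begin
  countBelow I N                                        ≡⟨ cong (countBelow I) (sym (m+[n∸m]≡n le)) ⟩
  countBelow I (lo + s + q)                             ≡⟨ cong (countBelow I) (+-assoc lo s q) ⟩
  countBelow I (lo + (s + q))                           ≡⟨ countBelow-+ I lo (s + q) ⟩
  countBelow I lo + countBelow (I ∘ (lo +_)) (s + q)    ≡⟨ cong₂ _+_ (countBelow-none I lo below) (countBelow-+ _ s q) ⟩
  countBelow (I ∘ (lo +_)) s + countBelow (λ y → I (lo + (s + y))) q
     ≡⟨ cong₂ _+_ (countBelow-all _ s (λ y → inInterval-+ lo s y)) (countBelow-none _ q (λ y _ → above y)) ⟩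
  s + 0                                                 ≡⟨ +-identityʳ s ⟩
  s                                                     ∎
  where
  open ≡-Reasoning
  I : ℕ → Bool
  I = inInterval lo s
  q : ℕ
  q = N ∸ (lo + s)
  below : ∀ x → x < lo → I x ≡ false
  below x l = ≢true⇒≡false (λ h → <⇒≱ l (≤ᵇ-true⇒≤ (∧-projˡ h)))
  above : ∀ y → I (lo + (s + y)) ≡ false
  above y = ≢true⇒≡false λ h → <⇒≱ (<ᵇ-true⇒< (∧-projʳ {lo ≤ᵇ lo + (s + y)} h))
                                    (subst (lo + s ≤_) (+-assoc lo s y) (m≤m+n _ _))

block-< : ∀ (size : ℕ → ℕ) ρ o ρ′ → o < size ρ → ρ < ρ′ → sumBelow size ρ + o < sumBelow size ρ′
block-< size ρ o ρ′ l l′ = <-≤-trans (+-monoʳ-< (sumBelow size ρ) l) (sumBelow-mono size (suc ρ) ρ′ l′)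

block-injective : ∀ (size : ℕ → ℕ) ρ o ρ′ o′ → o < size ρ → o′ < size ρ′
  → sumBelow size ρ + o ≡ sumBelow size ρ′ + o′ → ρ ≡ ρ′ × o ≡ o′
block-injective size ρ o ρ′ o′ l l′ e with <-cmp ρ ρ′
... | tri< a _ _ = ⊥-elim (<⇒≢ (≤-trans (block-< size ρ o ρ′ l a) (m≤m+n _ _)) e)
... | tri> _ _ a = ⊥-elim (<⇒≢ (≤-trans (block-< size ρ′ o′ ρ l′ a) (m≤m+n _ _)) (sym e))
... | tri≈ _ refl _ = refl , +-cancelˡ-≡ (sumBelow size ρ) _ _ e

incB⇒Inc : ∀ G e v → incB G e v ≡ true → Inc G e v
incB⇒Inc G e v h with src G e ≟ v | tgt G e ≟ v
... | yes p | _ = inj₁ p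
... | no _ | yes q = inj₂ q

Inc⇒incB : ∀ G e v → Inc G e v → incB G e v ≡ true
Inc⇒incB G e v (inj₁ p) with src G e ≟ v
... | yes _ = refl
... | no q = ⊥-elim (q p)
Inc⇒incB G e v (inj₂ p) with src G e ≟ v | tgt G e ≟ v
... | yes _ | _ = refl
... | no _ | yes _ = refl
... | no _ | no q = ⊥-elim (q p)

degree-sumFin : ∀ G v → degree G v ≡ sumFin (m G) (λ e → 𝟙 (incB G e v))
degree-sumFin G v = sum-map-allFin (m G) _

maxDegree-regular : ∀ G d → Regular G d → Fin (n G) → maxDegree G ≡ d
maxDegree-regular G d reg v = trans (cong (foldr _⊔_ 0) (map-tabulate (λ e → e) (degree G))) (max-constant (n G) v (degree G) reg)
  where
  max-constant : ∀ N → Fin N → (g : Fin N → ℕ) → (∀ x → g x ≡ d) → foldr _⊔_ 0 (tabulate g) ≡ d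
  max-constant (suc zero) _ g h = trans (⊔-identityʳ (g zero)) (h zero)
  max-constant (suc (suc N)) _ g h = trans (cong₂ _⊔_ (h zero) (max-constant (suc N) zero (g ∘ suc) (h ∘ suc))) (⊔-idem d)

module Palette (G : Graph) (c : Coloring G) where

  inPalette? : Fin (n G) → ℕ → Bool
  inPalette? v x = anyFin (m G) (λ e → incB G e v ∧ (c e ≡ᵇ x))

  inPalette?-sound : ∀ v x → inPalette? v x ≡ true → InPalette G c v x
  inPalette?-sound v x h =
    let (e , q) = anyFin-sound (m G) _ h in e , incB⇒Inc G e v (∧-projˡ q) , ≡ᵇ-true⇒≡ (∧-projʳ q)

  inPalette?-complete : ∀ v x → InPalette G c v x → inPalette? v x ≡ true
  inPalette?-complete v x (e , i , refl) = anyFin-complete (m G) _ e (∧-intro (Inc⇒incB G e v i) (≡ᵇ-refl (c e)))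

  inPalette?-edge : ∀ e v → Inc G e v → inPalette? v (c e) ≡ true
  inPalette?-edge e v i = inPalette?-complete v (c e) (e , i , refl)

  -- Properness: a colour occurs on at most one edge at v.
  palette-count : Proper G c → (Q : ℕ → Bool) (v : Fin (n G)) (M : ℕ) → (∀ e → c e < M)
    → sumFin (m G) (λ e → 𝟙 (incB G e v ∧ Q (c e))) ≡ countBelow (λ x → inPalette? v x ∧ Q x) M
  palette-count proper Q v M bound = trans (sumFin-cong (m G) below-M) (count-below M)
    where
    atMostOneEdge : ∀ x e e′ → (incB G e v ∧ (c e ≡ᵇ x)) ≡ true → (incB G e′ v ∧ (c e′ ≡ᵇ x)) ≡ true → e ≡ e′
    atMostOneEdge x e e′ h h′ with e ≟ e′
    ... | yes p = p
    ... | no p = ⊥-elim (proper e e′ p (v , incB⇒Inc G e v (∧-projˡ h) , incB⇒Inc G e′ v (∧-projˡ h′))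
                          (trans (≡ᵇ-true⇒≡ (∧-projʳ h)) (sym (≡ᵇ-true⇒≡ (∧-projʳ h′)))))

    colour-x : ∀ x → sumFin (m G) (λ e → 𝟙 ((incB G e v ∧ Q (c e)) ∧ (c e ≡ᵇ x))) ≡ 𝟙 (inPalette? v x ∧ Q x)
    colour-x x with Q x in Qx
    ... | true = trans (sumFin-cong (m G) drop-Q) (trans (sumFin-𝟙-unique (m G) _ (atMostOneEdge x)) (cong 𝟙 (sym (∧-identityʳ _))))
      where
      drop-Q : ∀ e → 𝟙 ((incB G e v ∧ Q (c e)) ∧ (c e ≡ᵇ x)) ≡ 𝟙 (incB G e v ∧ (c e ≡ᵇ x))
      drop-Q e = absorb (incB G e v) (Q (c e)) (c e ≡ᵇ x) (λ h → trans (cong Q (≡ᵇ-true⇒≡ h)) Qx)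
        where
        absorb : ∀ a q b → (b ≡ true → q ≡ true) → 𝟙 ((a ∧ q) ∧ b) ≡ 𝟙 (a ∧ b)
        absorb a q true h rewrite h refl = cong 𝟙 (∧-identityʳ _)
        absorb a q false _ = cong 𝟙 (trans (∧-zeroʳ _) (sym (∧-zeroʳ _)))
    ... | false = trans (sumFin-zero (m G) _ none) (cong 𝟙 (sym (∧-zeroʳ _)))
      where
      none : ∀ e → 𝟙 ((incB G e v ∧ Q (c e)) ∧ (c e ≡ᵇ x)) ≡ 0
      none e = vanish (incB G e v) (Q (c e)) (c e ≡ᵇ x) (λ h → trans (cong Q (≡ᵇ-true⇒≡ h)) Qx)
        where
        vanish : ∀ a q b → (b ≡ true → q ≡ false) → 𝟙 ((a ∧ q) ∧ b) ≡ 0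
        vanish a q true h rewrite h refl | ∧-zeroʳ a = refl
        vanish a q false _ = cong 𝟙 (∧-zeroʳ _)

    count-below : ∀ N → sumFin (m G) (λ e → 𝟙 ((incB G e v ∧ Q (c e)) ∧ (c e <ᵇ N))) ≡ countBelow (λ x → inPalette? v x ∧ Q x) N
    count-below zero = sumFin-zero (m G) _ (λ e → cong 𝟙 (∧-zeroʳ _))
    count-below (suc N) = trans (sumFin-cong (m G) (λ e → 𝟙-<ᵇ-suc _ (c e) N))
                            (trans (sumFin-distrib-+ (m G) _ _) (cong₂ _+_ (count-below N) (colour-x N)))
      where
      𝟙-<ᵇ-suc : ∀ b x N → 𝟙 (b ∧ (x <ᵇ suc N)) ≡ 𝟙 (b ∧ (x <ᵇ N)) + 𝟙 (b ∧ (x ≡ᵇ N))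
      𝟙-<ᵇ-suc false x N = refl
      𝟙-<ᵇ-suc true zero zero = refl
      𝟙-<ᵇ-suc true zero (suc N) = refl
      𝟙-<ᵇ-suc true (suc x) zero = refl
      𝟙-<ᵇ-suc true (suc x) (suc N) = 𝟙-<ᵇ-suc true x N

    below-M : ∀ e → 𝟙 (incB G e v ∧ Q (c e)) ≡ 𝟙 ((incB G e v ∧ Q (c e)) ∧ (c e <ᵇ M))
    below-M e rewrite <⇒<ᵇ-true (bound e) = cong 𝟙 (sym (∧-identityʳ _))

  palette-size≡degree : Proper G c → ∀ v M → (∀ e → c e < M) → countBelow (inPalette? v) M ≡ degree G v
  palette-size≡degree proper v M bound = begin
    countBelow (inPalette? v) M                   ≡⟨ countBelow-cong M (λ x _ → sym (∧-identityʳ _)) ⟩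
    countBelow (λ x → inPalette? v x ∧ true) M    ≡⟨ sym (palette-count proper (λ _ → true) v M bound) ⟩
    sumFin (m G) (λ e → 𝟙 (incB G e v ∧ true))    ≡⟨ sumFin-cong (m G) (λ e → cong 𝟙 (∧-identityʳ _)) ⟩
    sumFin (m G) (λ e → 𝟙 (incB G e v))           ≡⟨ sym (degree-sumFin G v) ⟩
    degree G v                                    ∎
    where open ≡-Reasoning

∀<-dec : ∀ N (p q : ℕ → Bool) → Dec (∀ x → x < N → p x ≡ q x)
∀<-dec zero p q = yes (λ x ())
∀<-dec (suc N) p q with ∀<-dec N p q | p N ≟𝔹 q N
... | no h | _ = no (λ a → h (λ x l → a x (m<n⇒m<1+n l)))
... | yes _ | no h = no (λ a → h (a N (n<1+n N)))
... | yes h | yes e = yes λ x l → [ h x , (λ { refl → e }) ]′ (m<1+n⇒m<n∨m≡n l)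

two-block-rank-injective : ∀ (S C O : ℕ → Bool) (code : ℕ → ℕ) M → (∀ x → S x ≡ true → x < M)
  → (∀ x → S x ≡ true → (C x ≡ true × code x ≡ rank C x) ⊎ (O x ≡ true × code x ≡ countBelow C M + rank O x))
  → ∀ x y → S x ≡ true → S y ≡ true → code x ≡ code y → x ≡ y
two-block-rank-injective S C O code M bound view x y sx sy e with view x sx | view y sy
... | inj₁ (cx , ex) | inj₁ (cy , ey) = rank-injective C x y cx cy (trans (sym ex) (trans e ey))
... | inj₂ (ox , ex) | inj₂ (oy , ey) = rank-injective O x y ox oy (+-cancelˡ-≡ (countBelow C M) _ _ (trans (sym ex) (trans e ey)))
... | inj₁ (cx , ex) | inj₂ (_ , ey) =
  ⊥-elim (<⇒≢ (≤-trans (rank-< C x M cx (bound x sx)) (m≤m+n _ _)) (trans (sym ex) (trans e ey)))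
... | inj₂ (_ , ex) | inj₁ (cy , ey) =
  ⊥-elim (<⇒≢ (≤-trans (rank-< C y M cy (bound y sy)) (m≤m+n _ _)) (sym (trans (sym ex) (trans e ey))))

palette-full : ∀ G s → Regular G s → (c : Coloring G) → Proper G c → (∀ e → c e < s)
  → ∀ u x → Palette.inPalette? G c u x ≡ (x <ᵇ s)
palette-full G s reg c proper bound u x with x <? s
... | yes l = trans (countBelow-full _ s all-colours x l) (sym (<⇒<ᵇ-true l))
  where
  open Palette G c
  all-colours : countBelow (inPalette? u) s ≡ s
  all-colours = trans (palette-size≡degree proper u s bound) (reg u)
... | no nl = trans (≢true⇒≡false no-edge) (sym (≮⇒<ᵇ-false nl))
  where
  no-edge : Palette.inPalette? G c u x ≢ true
  no-edge h with Palette.inPalette?-sound G c u x h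
  ... | e , _ , refl = nl (bound e)

Fin-empty-or-inhabited : ∀ N → (Fin N → ⊥) ⊎ Fin N
Fin-empty-or-inhabited zero = inj₁ λ ()
Fin-empty-or-inhabited (suc N) = inj₂ zero

module RegularColouring (G : Graph) (k : ℕ) (reg : Regular G k) (c : Coloring G) (proper : Proper G c) where

  open Palette G c public

  colourBound : ℕ
  colourBound = sumFin (m G) (suc ∘ c)

  c<colourBound : ∀ e → c e < colourBound
  c<colourBound = ≤-sumFin (m G) (suc ∘ c)

  degree-by-colours : ∀ v Q → sumFin (m G) (λ e → 𝟙 (incB G e v ∧ Q (c e))) ≡ countBelow (λ x → inPalette? v x ∧ Q x) colourBound
  degree-by-colours v Q = palette-count proper Q v colourBound c<colourBound

  palette-size : ∀ v → countBelow (inPalette? v) colourBound ≡ k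
  palette-size v = trans (palette-size≡degree proper v colourBound c<colourBound) (reg v)

  inPalette?⇒<colourBound : ∀ v x → inPalette? v x ≡ true → x < colourBound
  inPalette?⇒<colourBound v x h with inPalette?-sound v x h
  ... | e , _ , refl = c<colourBound e

  maxDegree≡k : ∀ e → maxDegree G ≡ k
  maxDegree≡k e = maxDegree-regular G k reg (src G e)

  infix 4 _≈ₚ_
  _≈ₚ_ : Fin (n G) → Fin (n G) → Set
  v ≈ₚ w = ∀ x → inPalette? v x ≡ inPalette? w x

  ≈ₚ-sym : ∀ {v w} → v ≈ₚ w → w ≈ₚ v
  ≈ₚ-sym s x = sym (s x)

  SamePalette⇒≈ₚ : ∀ v w → SamePalette G c v w → v ≈ₚ w
  SamePalette⇒≈ₚ v w s x = Bool-ext (λ h → inPalette?-complete w x (proj₁ (s x) (inPalette?-sound v x h)))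
                                    (λ h → inPalette?-complete v x (proj₂ (s x) (inPalette?-sound w x h)))

  ≈ₚ⇒SamePalette : ∀ v w → v ≈ₚ w → SamePalette G c v w
  ≈ₚ⇒SamePalette v w s x = (λ h → inPalette?-sound w x (trans (sym (s x)) (inPalette?-complete v x h)))
                         , (λ h → inPalette?-sound v x (trans (s x) (inPalette?-complete w x h)))

  _≈ₚ?_ : ∀ v w → Dec (v ≈ₚ w)
  v ≈ₚ? w with ∀<-dec colourBound (inPalette? v) (inPalette? w)
  ... | no h = no (λ s → h (λ x _ → s x))
  ... | yes h = yes λ x → agree x (x <? colourBound)
    where
    absent : ∀ u x → ¬ x < colourBound → inPalette? u x ≡ false
    absent u x nl = ≢true⇒≡false (nl ∘ inPalette?⇒<colourBound u x)
    agree : ∀ x → Dec (x < colourBound) → inPalette? v x ≡ inPalette? w x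
    agree x (yes l) = h x l
    agree x (no l) = trans (absent v x l) (sym (absent w x l))

  -- Colours common to both palettes are renumbered by their rank among the common colours,
  -- the remaining colours of each palette by their rank among its own private colours, after the common ones.
  module TwoPalettes (v₀ w₀ : Fin (n G)) (covers : ∀ u → u ≈ₚ v₀ ⊎ u ≈ₚ w₀) where

    A B common onlyA onlyB : ℕ → Bool
    A = inPalette? v₀
    B = inPalette? w₀
    common x = A x ∧ B x
    onlyA x = A x ∧ not (B x)
    onlyB x = B x ∧ not (A x)

    #common : ℕ
    #common = countBelow common colourBound

    recolour : ℕ → ℕ
    recolour x = if common x then rank common x else (if A x then #common + rank onlyA x else #common + rank onlyB x)

    module Side (v : Fin (n G)) (own : ℕ → Bool)
      (split : ∀ x → 𝟙 (inPalette? v x) ≡ 𝟙 (common x) + 𝟙 (own x))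
      (view : ∀ x → inPalette? v x ≡ true
            → (common x ≡ true × recolour x ≡ rank common x) ⊎ (own x ≡ true × recolour x ≡ #common + rank own x)) where

      #common+#own≡k : #common + countBelow own colourBound ≡ k
      #common+#own≡k = trans (sym (countBelow-split colourBound _ common own split)) (palette-size v)

      recolour-< : ∀ x → inPalette? v x ≡ true → recolour x < k
      recolour-< x h with view x h
      ... | inj₁ (cx , e) = subst (_< k) (sym e)
            (<-≤-trans (rank-< common x colourBound cx (inPalette?⇒<colourBound v x h)) (subst (#common ≤_) #common+#own≡k (m≤m+n _ _)))
      ... | inj₂ (ox , e) = subst (_< k) (sym e) (subst (#common + rank own x <_) #common+#own≡k
            (+-monoʳ-< #common (rank-< own x colourBound ox (inPalette?⇒<colourBound v x h))))

      recolour-injective : ∀ x y → inPalette? v x ≡ true → inPalette? v y ≡ true → recolour x ≡ recolour y → x ≡ y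
      recolour-injective = two-block-rank-injective (inPalette? v) common own recolour colourBound (inPalette?⇒<colourBound v) view

    splitA : ∀ x → 𝟙 (A x) ≡ 𝟙 (common x) + 𝟙 (onlyA x)
    splitA x with A x | B x
    ... | true | true = refl
    ... | true | false = refl
    ... | false | _ = refl

    viewA : ∀ x → A x ≡ true → (common x ≡ true × recolour x ≡ rank common x) ⊎ (onlyA x ≡ true × recolour x ≡ #common + rank onlyA x)
    viewA x h with A x | B x
    ... | true | true = inj₁ (refl , refl)
    ... | true | false = inj₂ (refl , refl)

    splitB : ∀ x → 𝟙 (B x) ≡ 𝟙 (common x) + 𝟙 (onlyB x)
    splitB x with A x | B x
    ... | true | true = refl
    ... | false | true = refl
    ... | true | false = refl
    ... | false | false = refl

    viewB : ∀ x → B x ≡ true → (common x ≡ true × recolour x ≡ rank common x) ⊎ (onlyB x ≡ true × recolour x ≡ #common + rank onlyB x)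
    viewB x h with A x | B x
    ... | true | true = inj₁ (refl , refl)
    ... | false | true = inj₂ (refl , refl)

    module SideA = Side v₀ onlyA splitA viewA
    module SideB = Side w₀ onlyB splitB viewB

    class1 : Class1 G
    class1 = recolour ∘ c , proper′ , bounded
      where
      at : ∀ {u v} → u ≈ₚ v → ∀ e → Inc G e u → inPalette? v (c e) ≡ true
      at s e i = trans (sym (s (c e))) (inPalette?-edge e _ i)
      proper′ : Proper G (recolour ∘ c)
      proper′ e₁ e₂ ne (u , i₁ , i₂) eq with covers u
      ... | inj₁ s = proper e₁ e₂ ne (u , i₁ , i₂) (SideA.recolour-injective _ _ (at s e₁ i₁) (at s e₂ i₂) eq)
      ... | inj₂ s = proper e₁ e₂ ne (u , i₁ , i₂) (SideB.recolour-injective _ _ (at s e₁ i₁) (at s e₂ i₂) eq)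
      bounded : ∀ e → recolour (c e) < maxDegree G
      bounded e rewrite maxDegree≡k e with covers (src G e)
      ... | inj₁ s = SideA.recolour-< (c e) (at s e (inj₁ refl))
      ... | inj₂ s = SideB.recolour-< (c e) (at s e (inj₁ refl))

  three-distinct-palettes : Class2 G → Σ (Fin 3 → Fin (n G)) λ v → ∀ i j → v i ≈ₚ v j → i ≡ j
  three-distinct-palettes class2 with Fin-empty-or-inhabited (n G)
  ... | inj₁ no-vertex = ⊥-elim (class2 ((λ _ → 0) , (λ e → ⊥-elim (no-vertex (src G e))) , (λ e → ⊥-elim (no-vertex (src G e)))))
  ... | inj₂ v₀ with any? (λ w → ¬? (v₀ ≈ₚ? w))
  ... | no h = ⊥-elim (class2 (TwoPalettes.class1 v₀ v₀ (λ u → inj₁ (≈ₚ-sym (same u)))))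
    where
    same : ∀ u → v₀ ≈ₚ u
    same u with v₀ ≈ₚ? u
    ... | yes s = s
    ... | no ns = ⊥-elim (h (u , ns))
  ... | yes (w , v₀≉w) with any? (λ u → ¬? (v₀ ≈ₚ? u) ×-dec ¬? (w ≈ₚ? u))
  ... | no h = ⊥-elim (class2 (TwoPalettes.class1 v₀ w covers))
    where
    covers : ∀ u → u ≈ₚ v₀ ⊎ u ≈ₚ w
    covers u with v₀ ≈ₚ? u | w ≈ₚ? u
    ... | yes s | _ = inj₁ (≈ₚ-sym s)
    ... | no _ | yes s = inj₂ (≈ₚ-sym s)
    ... | no a | no b = ⊥-elim (h (u , a , b))
  ... | yes (u , v₀≉u , w≉u) = vertex , distinct
    where
    vertex : Fin 3 → Fin (n G)
    vertex zero = v₀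
    vertex (suc zero) = w
    vertex (suc (suc zero)) = u
    distinct : ∀ i j → vertex i ≈ₚ vertex j → i ≡ j
    distinct zero zero _ = refl
    distinct (suc zero) (suc zero) _ = refl
    distinct (suc (suc zero)) (suc (suc zero)) _ = refl
    distinct zero (suc zero) s = ⊥-elim (v₀≉w s)
    distinct zero (suc (suc zero)) s = ⊥-elim (v₀≉u s)
    distinct (suc zero) (suc (suc zero)) s = ⊥-elim (w≉u s)
    distinct (suc zero) zero s = ⊥-elim (v₀≉w (≈ₚ-sym s))
    distinct (suc (suc zero)) zero s = ⊥-elim (v₀≉u (≈ₚ-sym s))
    distinct (suc (suc zero)) (suc zero) s = ⊥-elim (w≉u (≈ₚ-sym s))

class2⇒3≤palettes : ∀ G k → Regular G k → Class2 G → ∀ c → Proper G c → ∀ t → NumPalettes G c t → 3 ≤ t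
class2⇒3≤palettes G k reg class2 c proper t (f , _ , f-classes) = injective⇒≤ {f = f ∘ vertex} injective
  where
  open RegularColouring G k reg c proper
  vertex : Fin 3 → Fin (n G)
  vertex = proj₁ (three-distinct-palettes class2)
  injective : Injective _≡_ _≡_ (f ∘ vertex)
  injective {i} {j} eq = proj₂ (three-distinct-palettes class2) i j
    (SamePalette⇒≈ₚ (vertex i) (vertex j) (proj₁ (f-classes (vertex i) (vertex j)) eq))

class1⇒onePalette : ∀ G k → Regular G k → Fin (n G) → Class1 G → Σ (Coloring G) λ c → Proper G c × NumPalettes G c 1
class1⇒onePalette G k reg v₀ (c , proper , bound) = c , proper , (λ _ → zero) , onto , λ v w → (λ _ → same v w) , (λ _ → refl)
  where
  bound-k : ∀ e → c e < k
  bound-k e = subst (c e <_) (maxDegree-regular G k reg v₀) (bound e)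
  same : ∀ v w → SamePalette G c v w
  same v w = RegularColouring.≈ₚ⇒SamePalette G k reg c proper v w
               (λ x → trans (palette-full G k reg c proper bound-k v x) (sym (palette-full G k reg c proper bound-k w x)))
  onto : Surjective _≡_ _≡_ (λ (_ : Fin (n G)) → zero {0})
  onto zero = v₀ , λ _ → refl

Inc-lift : ∀ {G} (S : Subgraph G) e u → Inc (H S) e u → Inc G (emap S e) (vmap S u)
Inc-lift S e u (inj₁ p) = inj₁ (trans (src-pres S e) (cong (vmap S) p))
Inc-lift S e u (inj₂ p) = inj₂ (trans (tgt-pres S e) (cong (vmap S) p))

Inc-lower : ∀ {G} (S : Subgraph G) e u → Inc G (emap S e) (vmap S u) → Inc (H S) e u
Inc-lower S e u (inj₁ p) = inj₁ (vinj S (trans (sym (src-pres S e)) p))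
Inc-lower S e u (inj₂ p) = inj₂ (vinj S (trans (sym (tgt-pres S e)) p))

Inc-endpoint : ∀ {G} (S : Subgraph G) e v → Inc G (emap S e) v → Σ (Fin (n (H S))) λ u → vmap S u ≡ v × Inc (H S) e u
Inc-endpoint S e v (inj₁ p) = src (H S) e , trans (sym (src-pres S e)) p , inj₁ refl
Inc-endpoint S e v (inj₂ p) = tgt (H S) e , trans (sym (tgt-pres S e)) p , inj₂ refl

countFin : ∀ k → (Fin k → Bool) → ℕ
countFin k p = sumFin k (𝟙 ∘ p)

enumerate : ∀ k (p : Fin k → Bool) → Fin (countFin k p) → Fin k
enumerate (suc k) p i with p zero
enumerate (suc k) p zero | true = zero
enumerate (suc k) p (suc i) | true = suc (enumerate k (p ∘ suc) i)
enumerate (suc k) p i | false = suc (enumerate k (p ∘ suc) i)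

enumerate-satisfies : ∀ k (p : Fin k → Bool) i → p (enumerate k p i) ≡ true
enumerate-satisfies (suc k) p i with p zero in eq
enumerate-satisfies (suc k) p zero | true = eq
enumerate-satisfies (suc k) p (suc i) | true = enumerate-satisfies k _ i
enumerate-satisfies (suc k) p i | false = enumerate-satisfies k _ i

enumerate-injective : ∀ k p i j → enumerate k p i ≡ enumerate k p j → i ≡ j
enumerate-injective (suc k) p i j e with p zero
enumerate-injective (suc k) p zero zero e | true = refl
enumerate-injective (suc k) p (suc i) (suc j) e | true = cong suc (enumerate-injective k _ i j (suc-injective e))
enumerate-injective (suc k) p i j e | false = enumerate-injective k _ i j (suc-injective e)

enumerate-onto : ∀ k p (x : Fin k) → p x ≡ true → Σ (Fin (countFin k p)) λ i → enumerate k p i ≡ x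
enumerate-onto (suc k) p zero h with p zero | h
... | true | _ = zero , refl
enumerate-onto (suc k) p (suc x) h with p zero
... | true = let (i , e) = enumerate-onto k _ x h in suc i , cong suc e
... | false = let (i , e) = enumerate-onto k _ x h in i , cong suc e

sumFin-enumerate : ∀ k p (g : Fin k → ℕ) → sumFin (countFin k p) (g ∘ enumerate k p) ≡ sumFin k (λ x → if p x then g x else 0)
sumFin-enumerate zero p g = refl
sumFin-enumerate (suc k) p g with p zero
... | true = cong (g zero +_) (sumFin-enumerate k _ _)
... | false = sumFin-enumerate k _ _

module SelectedSubgraph (G : Graph) (keepEdge : Fin (m G) → Bool) (keepVertex : Fin (n G) → Bool)
  (src-kept : ∀ e → keepEdge e ≡ true → keepVertex (src G e) ≡ true)
  (tgt-kept : ∀ e → keepEdge e ≡ true → keepVertex (tgt G e) ≡ true) where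

  vmap′ : Fin (countFin (n G) keepVertex) → Fin (n G)
  vmap′ = enumerate (n G) keepVertex

  emap′ : Fin (countFin (m G) keepEdge) → Fin (m G)
  emap′ = enumerate (m G) keepEdge

  kept : ∀ e → keepEdge (emap′ e) ≡ true
  kept = enumerate-satisfies (m G) keepEdge

  src′ : ∀ e → Σ (Fin (countFin (n G) keepVertex)) λ u → vmap′ u ≡ src G (emap′ e)
  src′ e = enumerate-onto (n G) keepVertex _ (src-kept _ (kept e))

  tgt′ : ∀ e → Σ (Fin (countFin (n G) keepVertex)) λ u → vmap′ u ≡ tgt G (emap′ e)
  tgt′ e = enumerate-onto (n G) keepVertex _ (tgt-kept _ (kept e))

  graph : Graph
  graph = record
    { n = countFin (n G) keepVertex ; m = countFin (m G) keepEdge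
    ; src = proj₁ ∘ src′ ; tgt = proj₁ ∘ tgt′
    ; loopless = λ e eq → loopless G (emap′ e) (trans (sym (proj₂ (src′ e))) (trans (cong vmap′ eq) (proj₂ (tgt′ e)))) }

  subgraph : Subgraph G
  subgraph = record
    { H = graph ; vmap = vmap′ ; emap = emap′
    ; vinj = enumerate-injective (n G) keepVertex _ _
    ; einj = enumerate-injective (m G) keepEdge _ _
    ; src-pres = sym ∘ proj₂ ∘ src′
    ; tgt-pres = sym ∘ proj₂ ∘ tgt′ }

  incB-graph : ∀ e u → incB graph e u ≡ incB G (emap′ e) (vmap′ u)
  incB-graph e u = Bool-ext (λ h → Inc⇒incB G _ _ (Inc-lift subgraph e u (incB⇒Inc graph e u h)))
                            (λ h → Inc⇒incB graph _ _ (Inc-lower subgraph e u (incB⇒Inc G _ _ h)))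

  degree-graph : ∀ u → degree graph u ≡ sumFin (m G) (λ e → 𝟙 (incB G e (vmap′ u) ∧ keepEdge e))
  degree-graph u = begin
    degree graph u                                                       ≡⟨ degree-sumFin graph u ⟩
    sumFin _ (λ e → 𝟙 (incB graph e u))                                  ≡⟨ sumFin-cong _ (λ e → cong 𝟙 (incB-graph e u)) ⟩
    sumFin _ (λ e → 𝟙 (incB G (emap′ e) (vmap′ u)))                      ≡⟨ sumFin-enumerate (m G) keepEdge _ ⟩
    sumFin (m G) (λ e → if keepEdge e then 𝟙 (incB G e (vmap′ u)) else 0) ≡⟨ sumFin-cong (m G) (λ e → if-∧ (keepEdge e) _) ⟩
    sumFin (m G) (λ e → 𝟙 (incB G e (vmap′ u) ∧ keepEdge e))              ∎
    where
    open ≡-Reasoning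
    if-∧ : ∀ b a → (if b then 𝟙 a else 0) ≡ 𝟙 (a ∧ b)
    if-∧ true a = cong 𝟙 (sym (∧-identityʳ a))
    if-∧ false a = cong 𝟙 (sym (∧-zeroʳ a))

  proper-restriction : (c : Coloring G) →
    (∀ v e₁ e₂ → e₁ ≢ e₂ → Inc G e₁ v → Inc G e₂ v → keepEdge e₁ ≡ true → keepEdge e₂ ≡ true → c e₁ ≢ c e₂)
    → Proper graph (c ∘ emap′)
  proper-restriction c h e₁ e₂ ne (u , i₁ , i₂) =
    h (vmap′ u) (emap′ e₁) (emap′ e₂) (ne ∘ enumerate-injective (m G) keepEdge _ _)
      (Inc-lift subgraph e₁ u i₁) (Inc-lift subgraph e₂ u i₂) (kept e₁) (kept e₂)

  nonempty : ∀ u → 1 ≤ degree graph u → 1 ≤ m graph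
  nonempty u deg = sumFin-positive⇒nonempty (m graph) _ (subst (1 ≤_) (degree-sumFin graph _) deg)

argmin₃ : (x : Fin 3 → ℕ) → Σ (Fin 3) λ i → ∀ j → x i ≤ x j
argmin₃ x with ≤-total (x zero) (x (suc zero))
... | inj₁ a with ≤-total (x zero) (x (suc (suc zero)))
... | inj₁ b = zero , λ { zero → ≤-refl ; (suc zero) → a ; (suc (suc zero)) → b }
... | inj₂ b = suc (suc zero) , λ { zero → b ; (suc zero) → ≤-trans b a ; (suc (suc zero)) → ≤-refl }
argmin₃ x | inj₂ a with ≤-total (x (suc zero)) (x (suc (suc zero)))
... | inj₁ b = suc zero , λ { zero → a ; (suc zero) → ≤-refl ; (suc (suc zero)) → b }
... | inj₂ b = suc (suc zero) , λ { zero → ≤-trans b a ; (suc zero) → b ; (suc (suc zero)) → ≤-refl }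

record Offsets (x y : Fin 3 → ℕ) : Set where
  field
    m₀ : ℕ
    a : Fin 3 → ℕ
    d : ℕ
    x≡m₀+a : ∀ i → x i ≡ m₀ + a i
    y≡a+d : ∀ i → y i ≡ a i + d

balanced⇒offsets : (x y : Fin 3 → ℕ) → (∀ i j → x i + y j ≡ x j + y i) → Offsets x y
balanced⇒offsets x y balanced = record { m₀ = x i ; a = λ j → x j ∸ x i ; d = y i ; x≡m₀+a = x≡ ; y≡a+d = y≡ }
  where
  i : Fin 3
  i = proj₁ (argmin₃ x)
  x≡ : ∀ j → x j ≡ x i + (x j ∸ x i)
  x≡ j = sym (m+[n∸m]≡n (proj₂ (argmin₃ x) j))
  y≡ : ∀ j → y j ≡ (x j ∸ x i) + y i
  y≡ j = +-cancelˡ-≡ (x i) _ _ (trans (balanced i j) (trans (cong (_+ y i) (x≡ j)) (+-assoc (x i) _ (y i))))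

data Kind : Set where
  everywhere nowhere : Kind
  only allBut : Fin 3 → Kind

kindOf : Bool → Bool → Bool → Kind
kindOf true true true = everywhere
kindOf true false false = only zero
kindOf false true false = only (suc zero)
kindOf false false true = only (suc (suc zero))
kindOf false true true = allBut zero
kindOf true false true = allBut (suc zero)
kindOf true true false = allBut (suc (suc zero))
kindOf false false false = nowhere

member : Fin 3 → Kind → Bool
member j everywhere = true
member j nowhere = false
member j (only i) = eqᶠ i j
member j (allBut i) = not (eqᶠ i j)

sameKind : Kind → Kind → Bool
sameKind everywhere everywhere = true
sameKind nowhere nowhere = true
sameKind (only i) (only j) = eqᶠ i j
sameKind (allBut i) (allBut j) = eqᶠ i j
sameKind _ _ = false

sameKind-refl : ∀ t → sameKind t t ≡ true
sameKind-refl everywhere = refl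
sameKind-refl nowhere = refl
sameKind-refl (only i) = eqᶠ-refl i
sameKind-refl (allBut i) = eqᶠ-refl i

sameKind-true⇒≡ : ∀ {s t} → sameKind s t ≡ true → s ≡ t
sameKind-true⇒≡ {everywhere} {everywhere} h = refl
sameKind-true⇒≡ {nowhere} {nowhere} h = refl
sameKind-true⇒≡ {only i} {only j} h = cong only (eqᶠ-true⇒≡ h)
sameKind-true⇒≡ {allBut i} {allBut j} h = cong allBut (eqᶠ-true⇒≡ h)

other₁ other₂ : Fin 3 → Fin 3
other₁ zero = suc zero
other₁ (suc zero) = zero
other₁ (suc (suc zero)) = zero
other₂ zero = suc (suc zero)
other₂ (suc zero) = suc (suc zero)
other₂ (suc (suc zero)) = suc zero

i≢other₁ : ∀ i → not (eqᶠ i (other₁ i)) ≡ true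
i≢other₁ zero = refl
i≢other₁ (suc zero) = refl
i≢other₁ (suc (suc zero)) = refl

other₁≢i : ∀ i → not (eqᶠ (other₁ i) i) ≡ true
other₁≢i zero = refl
other₁≢i (suc zero) = refl
other₁≢i (suc (suc zero)) = refl

member-kindOf : ∀ (b : Fin 3 → Bool) j → member j (kindOf (b zero) (b (suc zero)) (b (suc (suc zero)))) ≡ b j
member-kindOf b j with b zero in e₀ | b (suc zero) in e₁ | b (suc (suc zero)) in e₂ | j
... | true  | true  | true  | zero = sym e₀
... | true  | true  | true  | suc zero = sym e₁
... | true  | true  | true  | suc (suc zero) = sym e₂
... | true  | false | false | zero = sym e₀
... | true  | false | false | suc zero = sym e₁
... | true  | false | false | suc (suc zero) = sym e₂
... | false | true  | false | zero = sym e₀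
... | false | true  | false | suc zero = sym e₁
... | false | true  | false | suc (suc zero) = sym e₂
... | false | false | true  | zero = sym e₀
... | false | false | true  | suc zero = sym e₁
... | false | false | true  | suc (suc zero) = sym e₂
... | false | true  | true  | zero = sym e₀
... | false | true  | true  | suc zero = sym e₁
... | false | true  | true  | suc (suc zero) = sym e₂
... | true  | false | true  | zero = sym e₀
... | true  | false | true  | suc zero = sym e₁
... | true  | false | true  | suc (suc zero) = sym e₂
... | true  | true  | false | zero = sym e₀
... | true  | true  | false | suc zero = sym e₁
... | true  | true  | false | suc (suc zero) = sym e₂
... | false | false | false | zero = sym e₀
... | false | false | false | suc zero = sym e₁
... | false | false | false | suc (suc zero) = sym e₂

member-by-kind : ∀ j t → 𝟙 (member j t)
  ≡ 𝟙 (sameKind t everywhere) + 𝟙 (sameKind t (only j)) + 𝟙 (sameKind t (allBut (other₁ j))) + 𝟙 (sameKind t (allBut (other₂ j)))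
member-by-kind j everywhere = refl
member-by-kind j nowhere = refl
member-by-kind zero (only zero) = refl
member-by-kind zero (only (suc zero)) = refl
member-by-kind zero (only (suc (suc zero))) = refl
member-by-kind (suc zero) (only zero) = refl
member-by-kind (suc zero) (only (suc zero)) = refl
member-by-kind (suc zero) (only (suc (suc zero))) = refl
member-by-kind (suc (suc zero)) (only zero) = refl
member-by-kind (suc (suc zero)) (only (suc zero)) = refl
member-by-kind (suc (suc zero)) (only (suc (suc zero))) = refl
member-by-kind zero (allBut zero) = refl
member-by-kind zero (allBut (suc zero)) = refl
member-by-kind zero (allBut (suc (suc zero))) = refl
member-by-kind (suc zero) (allBut zero) = refl
member-by-kind (suc zero) (allBut (suc zero)) = refl
member-by-kind (suc zero) (allBut (suc (suc zero))) = refl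
member-by-kind (suc (suc zero)) (allBut zero) = refl
member-by-kind (suc (suc zero)) (allBut (suc zero)) = refl
member-by-kind (suc (suc zero)) (allBut (suc (suc zero))) = refl

inRestKind : Kind → (Fin 3 → Bool) → Bool
inRestKind everywhere l = true
inRestKind nowhere l = false
inRestKind (only i) l = true
inRestKind (allBut i) l = l i

rest-member-by-kind : ∀ j t (l : Fin 3 → Bool) → 𝟙 (member j t ∧ inRestKind t l)
  ≡ 𝟙 (sameKind t everywhere) + 𝟙 (sameKind t (only j))
    + 𝟙 (sameKind t (allBut (other₁ j)) ∧ l (other₁ j)) + 𝟙 (sameKind t (allBut (other₂ j)) ∧ l (other₂ j))
rest-member-by-kind j everywhere l = refl
rest-member-by-kind j nowhere l = refl
rest-member-by-kind zero (only zero) l = refl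
rest-member-by-kind zero (only (suc zero)) l = refl
rest-member-by-kind zero (only (suc (suc zero))) l = refl
rest-member-by-kind (suc zero) (only zero) l = refl
rest-member-by-kind (suc zero) (only (suc zero)) l = refl
rest-member-by-kind (suc zero) (only (suc (suc zero))) l = refl
rest-member-by-kind (suc (suc zero)) (only zero) l = refl
rest-member-by-kind (suc (suc zero)) (only (suc zero)) l = refl
rest-member-by-kind (suc (suc zero)) (only (suc (suc zero))) l = refl
rest-member-by-kind zero (allBut zero) l = refl
rest-member-by-kind zero (allBut (suc zero)) l = sym (+-identityʳ _)
rest-member-by-kind zero (allBut (suc (suc zero))) l = refl
rest-member-by-kind (suc zero) (allBut zero) l = sym (+-identityʳ _)
rest-member-by-kind (suc zero) (allBut (suc zero)) l = refl
rest-member-by-kind (suc zero) (allBut (suc (suc zero))) l = refl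
rest-member-by-kind (suc (suc zero)) (allBut zero) l = sym (+-identityʳ _)
rest-member-by-kind (suc (suc zero)) (allBut (suc zero)) l = refl
rest-member-by-kind (suc (suc zero)) (allBut (suc (suc zero))) l = refl

regroup₁₃ : ∀ a b c d → a + b + c + d ≡ (a + c) + (b + d)
regroup₁₃ = solve-∀

regroup₁₄ : ∀ a b c d → a + b + c + d ≡ (a + d) + (b + c)
regroup₁₄ = solve-∀

-- Palette j consists of the d high colours of each kind allBut i with i ≠ j (those of rank at least
-- a i, forming part i) and of r = k - 2d rest colours.
module ThreePalettes (P : Fin 3 → ℕ → Bool) (M : ℕ) (P⇒<M : ∀ j x → P j x ≡ true → x < M)
                     (k : ℕ) (palette-size : ∀ j → countBelow (P j) M ≡ k) where

  kind : ℕ → Kind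
  kind x = kindOf (P zero x) (P (suc zero) x) (P (suc (suc zero)) x)

  P≡member : ∀ j x → P j x ≡ member j (kind x)
  P≡member j x = sym (member-kindOf (λ i → P i x) j)

  isKind : Kind → ℕ → Bool
  isKind t x = sameKind (kind x) t

  isKind-kind : ∀ {x t} → kind x ≡ t → isKind t x ≡ true
  isKind-kind {x} {t} e = trans (cong (λ s → sameKind s t) e) (sameKind-refl t)

  #_ : Kind → ℕ
  # t = countBelow (isKind t) M

  isKind⇒<M : ∀ t x → t ≢ nowhere → isKind t x ≡ true → x < M
  isKind⇒<M everywhere x _ h = P⇒<M zero x (trans (P≡member zero x) (cong (member zero) (sameKind-true⇒≡ {kind x} h)))
  isKind⇒<M nowhere x ne h = ⊥-elim (ne refl)
  isKind⇒<M (only i) x _ h = P⇒<M i x (trans (P≡member i x) (trans (cong (member i) (sameKind-true⇒≡ {kind x} h)) (eqᶠ-refl i)))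
  isKind⇒<M (allBut i) x _ h =
    P⇒<M (other₁ i) x (trans (P≡member (other₁ i) x) (trans (cong (member (other₁ i)) (sameKind-true⇒≡ {kind x} h)) (i≢other₁ i)))

  palette-size-by-kind : ∀ j → k ≡ # everywhere + # only j + # allBut (other₁ j) + # allBut (other₂ j)
  palette-size-by-kind j = trans (sym (palette-size j))
    (countBelow-split₄ M (P j) _ _ _ _ (λ x → trans (cong 𝟙 (P≡member j x)) (member-by-kind j (kind x))))

  balanced : ∀ i j → # only i + # allBut j ≡ # only j + # allBut i
  balanced zero zero = refl
  balanced (suc zero) (suc zero) = refl
  balanced (suc (suc zero)) (suc (suc zero)) = refl
  balanced zero (suc zero) = +-cancelˡ-≡ (# everywhere + # allBut (suc (suc zero))) _ _
    (trans (sym (regroup₁₄ (# everywhere) (# only zero) (# allBut (suc zero)) (# allBut (suc (suc zero)))))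
    (trans (sym (palette-size-by-kind zero)) (trans (palette-size-by-kind (suc zero))
      (regroup₁₄ (# everywhere) (# only (suc zero)) (# allBut zero) (# allBut (suc (suc zero)))))))
  balanced zero (suc (suc zero)) = +-cancelˡ-≡ (# everywhere + # allBut (suc zero)) _ _
    (trans (sym (regroup₁₃ (# everywhere) (# only zero) (# allBut (suc zero)) (# allBut (suc (suc zero)))))
    (trans (sym (palette-size-by-kind zero)) (trans (palette-size-by-kind (suc (suc zero)))
      (regroup₁₄ (# everywhere) (# only (suc (suc zero))) (# allBut zero) (# allBut (suc zero))))))
  balanced (suc zero) (suc (suc zero)) = +-cancelˡ-≡ (# everywhere + # allBut zero) _ _
    (trans (sym (regroup₁₃ (# everywhere) (# only (suc zero)) (# allBut zero) (# allBut (suc (suc zero)))))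
    (trans (sym (palette-size-by-kind (suc zero))) (trans (palette-size-by-kind (suc (suc zero)))
      (regroup₁₃ (# everywhere) (# only (suc (suc zero))) (# allBut zero) (# allBut (suc zero))))))
  balanced (suc zero) zero = sym (balanced zero (suc zero))
  balanced (suc (suc zero)) zero = sym (balanced zero (suc (suc zero)))
  balanced (suc (suc zero)) (suc zero) = sym (balanced (suc zero) (suc (suc zero)))

  open Offsets (balanced⇒offsets (λ i → # only i) (λ i → # allBut i) balanced) public

  r : ℕ
  r = # everywhere + m₀ + a zero + a (suc zero) + a (suc (suc zero))

  2d+r≡k : 2 * d + r ≡ k
  2d+r≡k = sym (begin
    k                                                                    ≡⟨ palette-size-by-kind zero ⟩
    # everywhere + # only zero + # allBut (suc zero) + # allBut (suc (suc zero))
      ≡⟨ cong₂ (λ u v → # everywhere + u + v + # allBut (suc (suc zero))) (x≡m₀+a zero) (y≡a+d (suc zero)) ⟩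
    # everywhere + (m₀ + a zero) + (a (suc zero) + d) + # allBut (suc (suc zero))
      ≡⟨ cong (# everywhere + (m₀ + a zero) + (a (suc zero) + d) +_) (y≡a+d (suc (suc zero))) ⟩
    # everywhere + (m₀ + a zero) + (a (suc zero) + d) + (a (suc (suc zero)) + d)
      ≡⟨ collect (# everywhere) m₀ (a zero) (a (suc zero)) (a (suc (suc zero))) d ⟩
    2 * d + r                                                            ∎)
    where
    open ≡-Reasoning
    collect : ∀ e m a₀ a₁ a₂ d → e + (m + a₀) + (a₁ + d) + (a₂ + d) ≡ 2 * d + (e + m + a₀ + a₁ + a₂)
    collect = solve-∀

  lowAllBut : Fin 3 → ℕ → Bool
  lowAllBut i x = rank (isKind (allBut i)) x <ᵇ a i

  inRest : ℕ → Bool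
  inRest x = inRestKind (kind x) (λ i → lowAllBut i x)

  inPart : Fin 3 → ℕ → Bool
  inPart i x = isKind (allBut i) x ∧ not (lowAllBut i x)

  partColour : Fin 3 → ℕ → ℕ
  partColour i x = rank (isKind (allBut i)) x ∸ a i

  #low : ∀ i → countBelow (λ x → isKind (allBut i) x ∧ lowAllBut i x) M ≡ a i
  #low i = trans (countBelow-rank< (isKind (allBut i)) (a i) M) (m≥n⇒m⊓n≡n (subst (a i ≤_) (sym (y≡a+d i)) (m≤m+n _ _)))

  rest-count : ∀ j → countBelow (λ x → P j x ∧ inRest x) M ≡ r
  rest-count j = begin
    countBelow (λ x → P j x ∧ inRest x) M
      ≡⟨ countBelow-split₄ M _ (isKind everywhere) (isKind (only j)) (low (other₁ j)) (low (other₂ j))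
           (λ x → trans (cong (λ b → 𝟙 (b ∧ inRest x)) (P≡member j x)) (rest-member-by-kind j (kind x) (λ i → lowAllBut i x))) ⟩
    # everywhere + # only j + countBelow (low (other₁ j)) M + countBelow (low (other₂ j)) M
      ≡⟨ cong₂ (λ u v → # everywhere + u + v + countBelow (low (other₂ j)) M) (x≡m₀+a j) (#low (other₁ j)) ⟩
    # everywhere + (m₀ + a j) + a (other₁ j) + countBelow (low (other₂ j)) M
      ≡⟨ cong (# everywhere + (m₀ + a j) + a (other₁ j) +_) (#low (other₂ j)) ⟩
    # everywhere + (m₀ + a j) + a (other₁ j) + a (other₂ j)
      ≡⟨ regroup j ⟩
    r ∎
    where
    open ≡-Reasoning
    low : Fin 3 → ℕ → Bool
    low i x = isKind (allBut i) x ∧ lowAllBut i x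
    regroup : ∀ j → # everywhere + (m₀ + a j) + a (other₁ j) + a (other₂ j) ≡ r
    regroup zero = +-assoc-lemma (# everywhere) m₀ (a zero) (a (suc zero)) (a (suc (suc zero)))
      where
      +-assoc-lemma : ∀ e m a₀ a₁ a₂ → e + (m + a₀) + a₁ + a₂ ≡ e + m + a₀ + a₁ + a₂
      +-assoc-lemma = solve-∀
    regroup (suc zero) = swap-lemma (# everywhere) m₀ (a zero) (a (suc zero)) (a (suc (suc zero)))
      where
      swap-lemma : ∀ e m a₀ a₁ a₂ → e + (m + a₁) + a₀ + a₂ ≡ e + m + a₀ + a₁ + a₂
      swap-lemma = solve-∀
    regroup (suc (suc zero)) = rotate-lemma (# everywhere) m₀ (a zero) (a (suc zero)) (a (suc (suc zero)))
      where
      rotate-lemma : ∀ e m a₀ a₁ a₂ → e + (m + a₂) + a₀ + a₁ ≡ e + m + a₀ + a₁ + a₂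
      rotate-lemma = solve-∀

  part-count : ∀ i j → i ≢ j → countBelow (λ x → P j x ∧ inPart i x) M ≡ d
  part-count i j i≢j = begin
    countBelow (λ x → P j x ∧ inPart i x) M  ≡⟨ countBelow-cong M (λ x _ → drop-P x) ⟩
    countBelow (inPart i) M                   ≡⟨ countBelow-rank≥ (isKind (allBut i)) (a i) M ⟩
    # allBut i ∸ a i                          ≡⟨ cong (_∸ a i) (y≡a+d i) ⟩
    a i + d ∸ a i                             ≡⟨ m+n∸m≡n (a i) d ⟩
    d                                         ∎
    where
    open ≡-Reasoning
    j-has-allBut-i : not (eqᶠ i j) ≡ true
    j-has-allBut-i with i ≟ j
    ... | yes p = ⊥-elim (i≢j p)
    ... | no _ = refl
    drop-P : ∀ x → (P j x ∧ inPart i x) ≡ inPart i x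
    drop-P x with isKind (allBut i) x in e
    ... | false = ∧-zeroʳ _
    ... | true = cong (_∧ not (lowAllBut i x)) (trans (P≡member j x) (trans (cong (member j) (sameKind-true⇒≡ {kind x} e)) j-has-allBut-i))

  inPart⇒kind : ∀ i x → inPart i x ≡ true → kind x ≡ allBut i
  inPart⇒kind i x h = sameKind-true⇒≡ {kind x} (∧-projˡ h)

  inPart⇒∉P : ∀ i x → inPart i x ≡ true → P i x ≡ false
  inPart⇒∉P i x h = trans (P≡member i x) (trans (cong (member i) (inPart⇒kind i x h)) (cong not (eqᶠ-refl i)))

  inPart⇒high : ∀ i x → inPart i x ≡ true → a i ≤ rank (isKind (allBut i)) x
  inPart⇒high i x h = <ᵇ-false⇒≥ (not≡true⇒≡false (∧-projʳ {isKind (allBut i) x} h))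

  partColour-injective : ∀ i x y → inPart i x ≡ true → inPart i y ≡ true → partColour i x ≡ partColour i y → x ≡ y
  partColour-injective i x y hx hy e = rank-injective (isKind (allBut i)) x y (∧-projˡ hx) (∧-projˡ hy)
    (trans (sym (m+[n∸m]≡n (inPart⇒high i x hx))) (trans (cong (a i +_) e) (m+[n∸m]≡n (inPart⇒high i y hy))))

  partColour-< : ∀ i x → inPart i x ≡ true → partColour i x < d
  partColour-< i x h = +-cancelˡ-< (a i) _ _ (subst (_< a i + d) (sym (m+[n∸m]≡n (inPart⇒high i x h)))
    (subst (rank (isKind (allBut i)) x <_) (y≡a+d i) (rank-< (isKind (allBut i)) x M (∧-projˡ h) (isKind⇒<M (allBut i) x (λ ()) (∧-projˡ h)))))

  rest-part-disjoint : ∀ i x → inRest x ≡ true → inPart i x ≡ true → ⊥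
  rest-part-disjoint i x hr hp = true≢false (begin
    true                                       ≡⟨ sym hr ⟩
    inRestKind (kind x) (λ i → lowAllBut i x)  ≡⟨ cong (λ t → inRestKind t (λ i → lowAllBut i x)) (inPart⇒kind i x hp) ⟩
    lowAllBut i x                              ≡⟨ ≮⇒<ᵇ-false (≤⇒≯ (inPart⇒high i x hp)) ⟩
    false                                      ∎)
    where open ≡-Reasoning

  parts-disjoint : ∀ i j x → inPart i x ≡ true → inPart j x ≡ true → i ≡ j
  parts-disjoint i j x hi hj = allBut-injective (trans (sym (inPart⇒kind i x hi)) (inPart⇒kind j x hj))
    where
    allBut-injective : ∀ {i j} → allBut i ≡ allBut j → i ≡ j
    allBut-injective refl = refl

  rest-or-part : ∀ j x → P j x ≡ true → inRest x ≡ true ⊎ Σ (Fin 3) λ i → inPart i x ≡ true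
  rest-or-part j x h = by-kind (kind x) refl (λ e → true≢false (trans (sym h) (trans (P≡member j x) (cong (member j) e))))
    where
    by-kind : ∀ t → kind x ≡ t → t ≢ nowhere → inRest x ≡ true ⊎ Σ (Fin 3) λ i → inPart i x ≡ true
    by-kind everywhere e _ = inj₁ (cong (λ s → inRestKind s (λ i → lowAllBut i x)) e)
    by-kind nowhere e ne = ⊥-elim (ne refl)
    by-kind (only i) e _ = inj₁ (cong (λ s → inRestKind s (λ i → lowAllBut i x)) e)
    by-kind (allBut i) e _ = bool-cases (lowAllBut i x)
      (λ low → inj₁ (trans (cong (λ s → inRestKind s (λ i → lowAllBut i x)) e) low))
      (λ high → inj₂ (i , ∧-intro (isKind-kind {x} e) (cong not high)))

  d≡0⇒rest : d ≡ 0 → ∀ j x → P j x ≡ true → inRest x ≡ true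
  d≡0⇒rest d≡0 j x h with rest-or-part j x h
  ... | inj₁ q = q
  ... | inj₂ (i , q) = ⊥-elim (n≮0 (subst (partColour i x <_) d≡0 (partColour-< i x q)))

  r≡0⇒¬rest : r ≡ 0 → ∀ j x → P j x ≡ true → inRest x ≡ false
  r≡0⇒¬rest r≡0 j x h = subst (λ b → b ∧ inRest x ≡ false) h (countBelow-zero _ M (trans (rest-count j) r≡0) x (P⇒<M j x h))

  -- Rest colours are packed into r colours by blocks: block 0 holds the kind everywhere, block 1 the
  -- first m₀ colours of each kind only j, and block 2 + i the other colours of kind only i and the low
  -- colours of kind allBut i.  Within one palette j, the block and offset determine kind and rank.
  blockSize : ℕ → ℕ
  blockSize 0 = # everywhere
  blockSize 1 = m₀
  blockSize 2 = a zero
  blockSize 3 = a (suc zero)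
  blockSize 4 = a (suc (suc zero))
  blockSize _ = 0

  block : Fin 3 → ℕ
  block i = 2 + toℕ i

  slotOf : Kind → ℕ → ℕ × ℕ
  slotOf everywhere x = 0 , rank (isKind everywhere) x
  slotOf nowhere x = 0 , 0
  slotOf (only i) x =
    if rank (isKind (only i)) x <ᵇ m₀ then (1 , rank (isKind (only i)) x) else (block i , rank (isKind (only i)) x ∸ m₀)
  slotOf (allBut i) x = block i , rank (isKind (allBut i)) x

  slot : ℕ → ℕ × ℕ
  slot x = slotOf (kind x) x

  restColour : ℕ → ℕ
  restColour x = sumBelow blockSize (proj₁ (slot x)) + proj₂ (slot x)

  kindInBlock : Fin 3 → Fin 3 → Kind
  kindInBlock j i = if eqᶠ i j then only j else allBut i

  kindAt : Fin 3 → ℕ → Kind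
  kindAt j 0 = everywhere
  kindAt j 1 = only j
  kindAt j 2 = kindInBlock j zero
  kindAt j 3 = kindInBlock j (suc zero)
  kindAt j 4 = kindInBlock j (suc (suc zero))
  kindAt j _ = nowhere

  rankAt : Fin 3 → ℕ → ℕ → ℕ
  rankAt j ρ o = if ρ ≡ᵇ block j then o + m₀ else o

  ValidSlot : Fin 3 → ℕ → ℕ × ℕ → Kind → Set
  ValidSlot j x (ρ , o) t = o < blockSize ρ × ρ < 5 × t ≡ kindAt j ρ × rank (isKind t) x ≡ rankAt j ρ o

  blockSize-block : ∀ i → blockSize (block i) ≡ a i
  blockSize-block zero = refl
  blockSize-block (suc zero) = refl
  blockSize-block (suc (suc zero)) = refl

  block<5 : ∀ i → block i < 5
  block<5 i = s≤s (s≤s (<-≤-trans (toℕ<n i) ≤-refl))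

  kindAt-block : ∀ j i → kindAt j (block i) ≡ kindInBlock j i
  kindAt-block j zero = refl
  kindAt-block j (suc zero) = refl
  kindAt-block j (suc (suc zero)) = refl

  block-≢ : ∀ i j → i ≢ j → (block i ≡ᵇ block j) ≡ false
  block-≢ i j i≢j = ≢true⇒≡false (i≢j ∘ toℕ-injective ∘ +-cancelˡ-≡ 2 _ _ ∘ ≡ᵇ-true⇒≡)

  slot-valid : ∀ j x → P j x ≡ true → inRest x ≡ true → ValidSlot j x (slot x) (kind x)
  slot-valid j x h hr = valid (kind x) refl (trans (sym (P≡member j x)) h) hr
    where
    valid : ∀ t → kind x ≡ t → member j t ≡ true → inRestKind t (λ i → lowAllBut i x) ≡ true → ValidSlot j x (slotOf t x) t
    valid everywhere e _ _ =
      rank-< (isKind everywhere) x M (isKind-kind {x} e) (isKind⇒<M everywhere x (λ ()) (isKind-kind {x} e)) , s≤s z≤n , refl , refl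
    valid nowhere e () _
    valid (only i) e i≡j _ with eqᶠ-true⇒≡ {i = i} {j} i≡j
    ... | refl = bool-cases (rank (isKind (only i)) x <ᵇ m₀)
      (λ low → subst (λ s → ValidSlot i x s (only i)) (sym (if-true low)) (<ᵇ-true⇒< low , s≤s (s≤s z≤n) , refl , refl))
      (λ high → subst (λ s → ValidSlot i x s (only i)) (sym (if-false high)) (high-slot (<ᵇ-false⇒≥ {rank (isKind (only i)) x} {m₀} high)))
      where
      rank< : rank (isKind (only i)) x < # only i
      rank< = rank-< (isKind (only i)) x M (isKind-kind {x} e) (isKind⇒<M (only i) x (λ ()) (isKind-kind {x} e))
      high-slot : m₀ ≤ rank (isKind (only i)) x → ValidSlot i x (block i , rank (isKind (only i)) x ∸ m₀) (only i)
      high-slot m₀≤ =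
        ( subst (rank (isKind (only i)) x ∸ m₀ <_) (sym (blockSize-block i))
            (+-cancelˡ-< m₀ (rank (isKind (only i)) x ∸ m₀) (a i)
              (subst (_< m₀ + a i) (sym (m+[n∸m]≡n m₀≤)) (subst (rank (isKind (only i)) x <_) (x≡m₀+a i) rank<)))
        , block<5 i
        , sym (trans (kindAt-block i i) (if-true (eqᶠ-refl i)))
        , sym (trans (if-true (≡ᵇ-refl (block i))) (m∸n+n≡m m₀≤)))
    valid (allBut i) e j∈ low =
      subst (rank (isKind (allBut i)) x <_) (sym (blockSize-block i)) (<ᵇ-true⇒< low) , block<5 i
      , sym (trans (kindAt-block j i) (if-false (not≡true⇒≡false j∈))) , sym (if-false (block-≢ i j i≢j))
      where
      i≢j : i ≢ j
      i≢j refl = true≢false (trans (sym (eqᶠ-refl i)) (not≡true⇒≡false j∈))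

  restColour-injective : ∀ j x y → P j x ≡ true → P j y ≡ true → inRest x ≡ true → inRest y ≡ true → restColour x ≡ restColour y → x ≡ y
  restColour-injective j x y hx hy rx ry e with slot x | slot-valid j x hx rx | slot y | slot-valid j y hy ry
  ... | (ρ , o) | (o< , _ , kx , rx′) | (ρ′ , o′) | (o′< , _ , ky , ry′) with block-injective blockSize ρ o ρ′ o′ o< o′< e
  ... | refl , refl = rank-injective (isKind (kind x)) x y (isKind-kind {x} refl) (isKind-kind {y} (trans ky (sym kx)))
                        (trans rx′ (trans (sym ry′) (cong (λ t → rank (isKind t) y) (trans ky (sym kx)))))

  restColour-< : ∀ j x → P j x ≡ true → inRest x ≡ true → restColour x < r
  restColour-< j x h hr with slot x | slot-valid j x h hr
  ... | (ρ , o) | (o< , ρ<5 , _ , _) = <-≤-trans (+-monoʳ-< (sumBelow blockSize ρ) o<) (sumBelow-mono blockSize (suc ρ) 5 ρ<5)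

-- From a colouring with three palettes to a decomposition

module PalettesToDecomposition (G : Graph) (k : ℕ) (reg : Regular G k) (c : Coloring G) (proper : Proper G c)
  (f : Fin (n G) → Fin 3) (f-onto : Surjective _≡_ _≡_ f)
  (f-classes : ∀ v w → (f v ≡ f w → SamePalette G c v w) × (SamePalette G c v w → f v ≡ f w))
  (class2 : Class2 G) where

  open RegularColouring G k reg c proper

  rep : Fin 3 → Fin (n G)
  rep i = proj₁ (f-onto i)

  f-rep : ∀ i → f (rep i) ≡ i
  f-rep i = proj₂ (f-onto i) refl

  P : Fin 3 → ℕ → Bool
  P i = inPalette? (rep i)

  inPalette?≡P : ∀ u x → inPalette? u x ≡ P (f u) x
  inPalette?≡P u = SamePalette⇒≈ₚ u (rep (f u)) (proj₁ (f-classes u (rep (f u))) (sym (f-rep (f u))))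

  open ThreePalettes P colourBound (λ j → inPalette?⇒<colourBound (rep j)) k (λ j → palette-size (rep j))

  edge∈P : ∀ e u → Inc G e u → P (f u) (c e) ≡ true
  edge∈P e u i = trans (sym (inPalette?≡P u (c e))) (inPalette?-edge e u i)

  src∈P : ∀ e → P (f (src G e)) (c e) ≡ true
  src∈P e = edge∈P e _ (inj₁ refl)

  -- With d = 0 every colour is a rest colour, and the packing gives a k-edge-colouring.
  1≤d : 1 ≤ d
  1≤d with d in d≡
  ... | suc _ = s≤s z≤n
  ... | zero = ⊥-elim (class2 (restColour ∘ c , proper′ , bounded))
    where
    r≡k : r ≡ k
    r≡k = trans (cong (λ d → 2 * d + r) (sym d≡)) 2d+r≡k
    rest : ∀ e u → Inc G e u → inRest (c e) ≡ true
    rest e u i = d≡0⇒rest d≡ (f u) (c e) (edge∈P e u i)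
    proper′ : Proper G (restColour ∘ c)
    proper′ e₁ e₂ ne (u , i₁ , i₂) eq = proper e₁ e₂ ne (u , i₁ , i₂)
      (restColour-injective (f u) (c e₁) (c e₂) (edge∈P e₁ u i₁) (edge∈P e₂ u i₂) (rest e₁ u i₁) (rest e₂ u i₂) eq)
    bounded : ∀ e → restColour (c e) < maxDegree G
    bounded e = subst (restColour (c e) <_) (trans r≡k (sym (maxDegree≡k e))) (restColour-< (f (src G e)) (c e) (src∈P e) (rest e _ (inj₁ refl)))

  r<k : r < k
  r<k = subst (r <_) 2d+r≡k (+-monoˡ-≤ r (≤-trans 1≤d (m≤m+n d (d + 0))))

  module ColourClassSubgraph (q : ℕ → Bool) (keepVertex : Fin (n G) → Bool)
    (src-kept : ∀ e → q (c e) ≡ true → keepVertex (src G e) ≡ true)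
    (tgt-kept : ∀ e → q (c e) ≡ true → keepVertex (tgt G e) ≡ true)
    (s : ℕ) (recolour : ℕ → ℕ)
    (degree≡s : ∀ u → keepVertex u ≡ true → countBelow (λ x → P (f u) x ∧ q x) colourBound ≡ s)
    (recolour-injective : ∀ j x y → P j x ≡ true → P j y ≡ true → q x ≡ true → q y ≡ true → recolour x ≡ recolour y → x ≡ y)
    (recolour-< : ∀ j x → P j x ≡ true → q x ≡ true → recolour x < s) where

    open SelectedSubgraph G (q ∘ c) keepVertex src-kept tgt-kept public

    regular : Regular graph s
    regular u = begin
      degree graph u                                                ≡⟨ degree-graph u ⟩
      sumFin (m G) (λ e → 𝟙 (incB G e (vmap′ u) ∧ q (c e)))          ≡⟨ degree-by-colours (vmap′ u) q ⟩
      countBelow (λ x → inPalette? (vmap′ u) x ∧ q x) colourBound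
        ≡⟨ countBelow-cong colourBound (λ x _ → cong (_∧ q x) (inPalette?≡P (vmap′ u) x)) ⟩
      countBelow (λ x → P (f (vmap′ u)) x ∧ q x) colourBound        ≡⟨ degree≡s (vmap′ u) (enumerate-satisfies (n G) keepVertex u) ⟩
      s                                                             ∎
      where open ≡-Reasoning

    class1 : Class1 graph
    class1 = recolour ∘ c ∘ emap′ , proper-restriction (recolour ∘ c) proper′ , bounded
      where
      proper′ : ∀ v e₁ e₂ → e₁ ≢ e₂ → Inc G e₁ v → Inc G e₂ v → q (c e₁) ≡ true → q (c e₂) ≡ true
        → recolour (c e₁) ≢ recolour (c e₂)
      proper′ v e₁ e₂ ne i₁ i₂ q₁ q₂ eq =
        proper e₁ e₂ ne (v , i₁ , i₂) (recolour-injective (f v) _ _ (edge∈P e₁ v i₁) (edge∈P e₂ v i₂) q₁ q₂ eq)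
      bounded : ∀ e → recolour (c (emap′ e)) < maxDegree graph
      bounded e = subst (recolour (c (emap′ e)) <_) (sym (maxDegree-regular graph s regular (src graph e)))
                    (recolour-< (f (src G (emap′ e))) _ (src∈P (emap′ e)) (kept e))

    nonempty-of : ∀ v → keepVertex v ≡ true → 1 ≤ s → 1 ≤ m graph
    nonempty-of v h 1≤s = nonempty u (subst (1 ≤_) (sym (regular u)) 1≤s)
      where
      u : Fin (n graph)
      u = proj₁ (enumerate-onto (n G) keepVertex v h)

    covers : ∀ e → q (c e) ≡ true → ∃ λ e′ → emap′ e′ ≡ e
    covers e h = enumerate-onto (m G) (q ∘ c) e h

  missing : Fin 3 → Fin (n G) → Bool
  missing i u = not (eqᶠ (f u) i)

  P-missing : ∀ j x i → P j x ≡ true → P i x ≡ false → not (eqᶠ j i) ≡ true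
  P-missing j x i h h′ with j ≟ i
  ... | yes refl = ⊥-elim (true≢false (trans (sym h) h′))
  ... | no _ = refl

  missing⇒≢ : ∀ (j i : Fin 3) → not (eqᶠ j i) ≡ true → i ≢ j
  missing⇒≢ j i h refl = true≢false (trans (sym h) (cong not (eqᶠ-refl i)))

  module Part (i : Fin 3) = ColourClassSubgraph (inPart i) (missing i)
    (λ e h → P-missing (f (src G e)) (c e) i (edge∈P e _ (inj₁ refl)) (inPart⇒∉P i (c e) h))
    (λ e h → P-missing (f (tgt G e)) (c e) i (edge∈P e _ (inj₂ refl)) (inPart⇒∉P i (c e) h))
    d (partColour i) (λ u h → part-count i (f u) (missing⇒≢ (f u) i h))
    (λ _ x y _ _ → partColour-injective i x y) (λ _ x _ → partColour-< i x)

  module Rest = ColourClassSubgraph inRest (λ _ → true) (λ _ _ → refl) (λ _ _ → refl)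
    r restColour (λ u _ → rest-count (f u)) restColour-injective restColour-<

  part-nonempty : ∀ i → 1 ≤ m (Part.graph i)
  part-nonempty i = Part.nonempty-of i (rep (other₁ i)) (subst (λ j → not (eqᶠ j i) ≡ true) (sym (f-rep (other₁ i))) (other₁≢i i)) 1≤d

  parts-disjoint′ : ∀ i j e e′ → emap (Part.subgraph i) e ≡ emap (Part.subgraph j) e′ → i ≡ j
  parts-disjoint′ i j e e′ eq = parts-disjoint i j _ (Part.kept i e) (subst (λ z → inPart j (c z) ≡ true) (sym eq) (Part.kept j e′))

  parts-regular-class1 : ∀ i → Regular (H (Part.subgraph i)) d × Class1 (H (Part.subgraph i))
  parts-regular-class1 i = Part.regular i , Part.class1 i

  decomposition-r≡0 : r ≡ 0 → Σ (Fin 3 → Subgraph G) λ F → Decomposition G 3 F × (∀ i → Regular (H (F i)) d × Class1 (H (F i)))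
  decomposition-r≡0 r≡0 = Part.subgraph , (part-nonempty , parts-disjoint′ , covers) , parts-regular-class1
    where
    covers : ∀ e → ∃ λ i → ∃ λ (e′ : Fin (m (H (Part.subgraph i)))) → emap (Part.subgraph i) e′ ≡ e
    covers e with rest-or-part (f (src G e)) (c e) (src∈P e)
    ... | inj₁ h = ⊥-elim (true≢false (trans (sym h) (r≡0⇒¬rest r≡0 _ (c e) (src∈P e))))
    ... | inj₂ (i , h) = i , Part.covers i e h

  family₄ : Fin 4 → Subgraph G
  family₄ zero = Part.subgraph zero
  family₄ (suc zero) = Part.subgraph (suc zero)
  family₄ (suc (suc zero)) = Part.subgraph (suc (suc zero))
  family₄ (suc (suc (suc zero))) = Rest.subgraph

  colourClass₄ : Fin 4 → ℕ → Bool
  colourClass₄ zero = inPart zero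
  colourClass₄ (suc zero) = inPart (suc zero)
  colourClass₄ (suc (suc zero)) = inPart (suc (suc zero))
  colourClass₄ (suc (suc (suc zero))) = inRest

  family₄-kept : ∀ i e → colourClass₄ i (c (emap (family₄ i) e)) ≡ true
  family₄-kept zero = Part.kept zero
  family₄-kept (suc zero) = Part.kept (suc zero)
  family₄-kept (suc (suc zero)) = Part.kept (suc (suc zero))
  family₄-kept (suc (suc (suc zero))) = Rest.kept

  colourClass₄-disjoint : ∀ i j x → colourClass₄ i x ≡ true → colourClass₄ j x ≡ true → i ≡ j
  colourClass₄-disjoint (suc (suc (suc zero))) (suc (suc (suc zero))) x _ _ = refl
  colourClass₄-disjoint (suc (suc (suc zero))) zero x a b = ⊥-elim (rest-part-disjoint zero x a b)
  colourClass₄-disjoint (suc (suc (suc zero))) (suc zero) x a b = ⊥-elim (rest-part-disjoint (suc zero) x a b)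
  colourClass₄-disjoint (suc (suc (suc zero))) (suc (suc zero)) x a b = ⊥-elim (rest-part-disjoint (suc (suc zero)) x a b)
  colourClass₄-disjoint zero (suc (suc (suc zero))) x a b = ⊥-elim (rest-part-disjoint zero x b a)
  colourClass₄-disjoint (suc zero) (suc (suc (suc zero))) x a b = ⊥-elim (rest-part-disjoint (suc zero) x b a)
  colourClass₄-disjoint (suc (suc zero)) (suc (suc (suc zero))) x a b = ⊥-elim (rest-part-disjoint (suc (suc zero)) x b a)
  colourClass₄-disjoint zero zero x a b = refl
  colourClass₄-disjoint zero (suc zero) x a b = cong inject₁ (parts-disjoint zero (suc zero) x a b)
  colourClass₄-disjoint zero (suc (suc zero)) x a b = cong inject₁ (parts-disjoint zero (suc (suc zero)) x a b)
  colourClass₄-disjoint (suc zero) zero x a b = cong inject₁ (parts-disjoint (suc zero) zero x a b)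
  colourClass₄-disjoint (suc zero) (suc zero) x a b = refl
  colourClass₄-disjoint (suc zero) (suc (suc zero)) x a b = cong inject₁ (parts-disjoint (suc zero) (suc (suc zero)) x a b)
  colourClass₄-disjoint (suc (suc zero)) zero x a b = cong inject₁ (parts-disjoint (suc (suc zero)) zero x a b)
  colourClass₄-disjoint (suc (suc zero)) (suc zero) x a b = cong inject₁ (parts-disjoint (suc (suc zero)) (suc zero) x a b)
  colourClass₄-disjoint (suc (suc zero)) (suc (suc zero)) x a b = refl

  decomposition-r≥1 : 1 ≤ r → Σ (Fin 4 → Subgraph G) λ F → Decomposition G 4 F
    × (∀ (i : Fin 3) → Regular (H (F (inject₁ i))) d × Class1 (H (F (inject₁ i))))
    × Spanning (F (fromℕ 3)) × Regular (H (F (fromℕ 3))) r × Class1 (H (F (fromℕ 3)))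
  decomposition-r≥1 1≤r = family₄ , (nonempty , disjoint , covers) , parts , spanning , Rest.regular , Rest.class1
    where
    nonempty : ∀ i → 1 ≤ m (H (family₄ i))
    nonempty zero = part-nonempty zero
    nonempty (suc zero) = part-nonempty (suc zero)
    nonempty (suc (suc zero)) = part-nonempty (suc (suc zero))
    nonempty (suc (suc (suc zero))) = Rest.nonempty-of (rep zero) refl 1≤r
    disjoint : ∀ i j (e : Fin (m (H (family₄ i)))) (e′ : Fin (m (H (family₄ j)))) → emap (family₄ i) e ≡ emap (family₄ j) e′ → i ≡ j
    disjoint i j e e′ eq = colourClass₄-disjoint i j _ (family₄-kept i e) (subst (λ z → colourClass₄ j (c z) ≡ true) (sym eq) (family₄-kept j e′))
    covers : ∀ e → ∃ λ i → ∃ λ (e′ : Fin (m (H (family₄ i)))) → emap (family₄ i) e′ ≡ e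
    covers e with rest-or-part (f (src G e)) (c e) (src∈P e)
    ... | inj₁ h = suc (suc (suc zero)) , Rest.covers e h
    ... | inj₂ (zero , h) = zero , Part.covers zero e h
    ... | inj₂ (suc zero , h) = suc zero , Part.covers (suc zero) e h
    ... | inj₂ (suc (suc zero) , h) = suc (suc zero) , Part.covers (suc (suc zero)) e h
    parts : ∀ (i : Fin 3) → Regular (H (family₄ (inject₁ i))) d × Class1 (H (family₄ (inject₁ i)))
    parts zero = parts-regular-class1 zero
    parts (suc zero) = parts-regular-class1 (suc zero)
    parts (suc (suc zero)) = parts-regular-class1 (suc (suc zero))
    spanning : Spanning (family₄ (fromℕ 3))
    spanning v = let (u , e) = enumerate-onto (n G) (λ _ → true) v refl in u , λ { refl → e }

  three-palettes⇒decomposition : Σ ℕ (λ r → r < k × DecompCondition G k r)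
  three-palettes⇒decomposition with r in r≡
  ... | zero = r , r<k , d , 2d+r≡k , inj₁ (r≡ , decomposition-r≡0 r≡)
  ... | suc _ = r , r<k , d , 2d+r≡k , inj₂ (subst (1 ≤_) (sym r≡) (s≤s z≤n) , decomposition-r≥1 (subst (1 ≤_) (sym r≡) (s≤s z≤n)))

-- From a decomposition to a colouring with few palettes

-- Part i is coloured with the interval of colours starting at the total size of the parts before it,
-- so the palette of a vertex is the union of the intervals of the parts containing it.
module GluedColouring (G : Graph) (t : ℕ) (F : Fin t → Subgraph G) (dec : Decomposition G t F)
  (s : Fin t → ℕ) (regular : ∀ i → Regular (H (F i)) (s i)) (class1 : ∀ i → Class1 (H (F i))) where

  open Palette G using (inPalette?; inPalette?-sound; inPalette?-complete; palette-size≡degree)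

  size : ℕ → ℕ
  size x with x <? t
  ... | yes x<t = s (fromℕ< x<t)
  ... | no _ = 0

  size-toℕ : ∀ i → size (toℕ i) ≡ s i
  size-toℕ i with toℕ i <? t
  ... | yes l = cong s (fromℕ<-toℕ i l)
  ... | no l = ⊥-elim (l (toℕ<n i))

  offset : Fin t → ℕ
  offset i = sumBelow size (toℕ i)

  colour : ∀ i → Coloring (H (F i))
  colour i = proj₁ (class1 i)

  colour-proper : ∀ i → Proper (H (F i)) (colour i)
  colour-proper i = proj₁ (proj₂ (class1 i))

  colour-< : ∀ i e → colour i e < s i
  colour-< i e = subst (colour i e <_) (maxDegree-regular (H (F i)) (s i) (regular i) (src (H (F i)) e)) (proj₂ (proj₂ (class1 i)) e)

  colour-<size : ∀ i e → colour i e < size (toℕ i)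
  colour-<size i e = subst (colour i e <_) (sym (size-toℕ i)) (colour-< i e)

  Preimage : Fin (m G) → Set
  Preimage e = ∃ λ i → ∃ λ (e′ : Fin (m (H (F i)))) → emap (F i) e′ ≡ e

  colourVia : ∀ e → Preimage e → ℕ
  colourVia e (i , e′ , _) = offset i + colour i e′

  colourVia-unique : ∀ e (p q : Preimage e) → colourVia e p ≡ colourVia e q
  colourVia-unique e (i , e₁ , eq₁) (j , e₂ , eq₂) with proj₁ (proj₂ dec) i j e₁ e₂ (trans eq₁ (sym eq₂))
  ... | refl with einj (F i) (trans eq₁ (sym eq₂))
  ... | refl = refl

  glued : Coloring G
  glued e = colourVia e (proj₂ (proj₂ dec) e)

  glued-emap : ∀ i e → glued (emap (F i) e) ≡ offset i + colour i e
  glued-emap i e = colourVia-unique _ (proj₂ (proj₂ dec) _) (i , e , refl)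

  glued-proper : Proper G glued
  glued-proper e₁ e₂ ne (v , i₁ , i₂) = proper-via v e₁ e₂ (proj₂ (proj₂ dec) e₁) (proj₂ (proj₂ dec) e₂) ne i₁ i₂
    where
    proper-via : ∀ v e₁ e₂ (p₁ : Preimage e₁) (p₂ : Preimage e₂) → e₁ ≢ e₂ → Inc G e₁ v → Inc G e₂ v
      → colourVia e₁ p₁ ≢ colourVia e₂ p₂
    proper-via v _ _ (a , e₁′ , refl) (b , e₂′ , refl) ne i₁ i₂ eq with a ≟ b
    ... | no a≢b = a≢b (toℕ-injective (proj₁ (block-injective size (toℕ a) _ (toℕ b) _ (colour-<size a e₁′) (colour-<size b e₂′) eq)))
    ... | yes refl with Inc-endpoint (F a) e₁′ v i₁
    ... | u , vu , j₁ = colour-proper a e₁′ e₂′ (ne ∘ cong (emap (F a)))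
          (u , j₁ , Inc-lower (F a) e₂′ u (subst (Inc G _) (sym vu) i₂)) (+-cancelˡ-≡ (offset a) _ _ eq)

  #colours : ℕ
  #colours = sumBelow size t

  interval≤#colours : ∀ i → offset i + s i ≤ #colours
  interval≤#colours i = subst (_≤ #colours) (cong (offset i +_) (size-toℕ i)) (sumBelow-mono size (suc (toℕ i)) t (toℕ<n i))

  glued-< : ∀ e → glued e < #colours
  glued-< e with proj₂ (proj₂ dec) e
  ... | (i , e′ , _) = <-≤-trans (+-monoʳ-< (offset i) (colour-< i e′)) (interval≤#colours i)

  inPart? : Fin t → Fin (n G) → Bool
  inPart? i v = anyFin (n (H (F i))) (λ u → eqᶠ (vmap (F i) u) v)

  inPart?-intro : ∀ i u v → vmap (F i) u ≡ v → inPart? i v ≡ true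
  inPart?-intro i u v eq = anyFin-complete _ _ u (subst (λ z → eqᶠ (vmap (F i) u) z ≡ true) eq (eqᶠ-refl (vmap (F i) u)))

  inInterval? : Fin t → ℕ → Bool
  inInterval? i = inInterval (offset i) (s i)

  intervals-disjoint : ∀ i j x → inInterval? i x ≡ true → inInterval? j x ≡ true → i ≡ j
  intervals-disjoint i j x hi hj = toℕ-injective (proj₁ (block-injective size (toℕ i) _ (toℕ j) _
    (subst (x ∸ offset i <_) (sym (size-toℕ i)) (proj₂ offset-i))
    (subst (x ∸ offset j <_) (sym (size-toℕ j)) (proj₂ offset-j))
    (trans (proj₁ offset-i) (sym (proj₁ offset-j)))))
    where
    offset-i : offset i + (x ∸ offset i) ≡ x × x ∸ offset i < s i
    offset-i = inInterval-offset (offset i) (s i) x hi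
    offset-j : offset j + (x ∸ offset j) ≡ x × x ∸ offset j < s j
    offset-j = inInterval-offset (offset j) (s j) x hj

  palette-glued : ∀ v x → inPalette? glued v x ≡ anyFin t (λ i → inPart? i v ∧ inInterval? i x)
  palette-glued v x = Bool-ext to from
    where
    to-via : ∀ e (p : Preimage e) → Inc G e v → colourVia e p ≡ x → anyFin t (λ i → inPart? i v ∧ inInterval? i x) ≡ true
    to-via _ (i , e′ , refl) inc eq with Inc-endpoint (F i) e′ v inc
    ... | u , vu , _ = anyFin-complete t _ i (∧-intro (inPart?-intro i u v vu)
                         (subst (λ z → inInterval? i z ≡ true) eq (inInterval-+ (offset i) (s i) _ (colour-< i e′))))
    to : inPalette? glued v x ≡ true → anyFin t (λ i → inPart? i v ∧ inInterval? i x) ≡ true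
    to h with inPalette?-sound glued v x h
    ... | e , inc , eq = to-via e (proj₂ (proj₂ dec) e) inc eq
    -- The colour x is used at v inside part i, since every colour of part i appears at each of its vertices.
    from : anyFin t (λ i → inPart? i v ∧ inInterval? i x) ≡ true → inPalette? glued v x ≡ true
    from h with anyFin-sound t _ h
    ... | i , q with anyFin-sound _ _ (∧-projˡ q) | inInterval-offset (offset i) (s i) x (∧-projʳ {inPart? i v} q)
    ... | u , vu | x≡ , x-offset< with palette-full (H (F i)) (s i) (regular i) (colour i) (colour-proper i) (colour-< i) u (x ∸ offset i)
    ... | full with Palette.inPalette?-sound (H (F i)) (colour i) u (x ∸ offset i) (trans full (<⇒<ᵇ-true x-offset<))
    ... | e′ , inc , ce = inPalette?-complete glued v x (emap (F i) e′ , subst (Inc G (emap (F i) e′)) (eqᶠ-true⇒≡ vu) (Inc-lift (F i) e′ u inc)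
                            , trans (glued-emap i e′) (trans (cong (offset i +_) ce) x≡))

  degree-by-parts : ∀ k → Regular G k → ∀ v → sumFin t (λ i → if inPart? i v then s i else 0) ≡ k
  degree-by-parts k reg v = sym (begin
    k                                                                 ≡⟨ sym (reg v) ⟩
    degree G v                                                        ≡⟨ sym (palette-size≡degree glued glued-proper v #colours glued-<) ⟩
    countBelow (inPalette? glued v) #colours                          ≡⟨ countBelow-cong #colours (λ x _ → palette-glued v x) ⟩
    countBelow (λ x → anyFin t (λ i → inPart? i v ∧ inInterval? i x)) #colours
      ≡⟨ sumBelow-cong #colours (λ x _ → sym (sumFin-𝟙-unique t _ λ i j a b →
           intervals-disjoint i j x (∧-projʳ {inPart? i v} a) (∧-projʳ {inPart? j v} b))) ⟩
    sumBelow (λ x → sumFin t (λ i → 𝟙 (inPart? i v ∧ inInterval? i x))) #colours ≡⟨ sumBelow-sumFin #colours t _ ⟩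
    sumFin t (λ i → countBelow (λ x → inPart? i v ∧ inInterval? i x) #colours)  ≡⟨ sumFin-cong t per-part ⟩
    sumFin t (λ i → if inPart? i v then s i else 0)                   ∎)
    where
    open ≡-Reasoning
    per-part : ∀ i → countBelow (λ x → inPart? i v ∧ inInterval? i x) #colours ≡ (if inPart? i v then s i else 0)
    per-part i with inPart? i v
    ... | true = countBelow-inInterval (offset i) (s i) #colours (interval≤#colours i)
    ... | false = countBelow-none _ #colours (λ _ _ → refl)

exactly-one-false : ∀ d → 1 ≤ d → (b : Fin 3 → Bool) → sumFin 3 (λ i → if b i then d else 0) ≡ d + d
  → Σ (Fin 3) λ j → ∀ i → b i ≡ not (eqᶠ i j)
exactly-one-false d 1≤d b h with b zero in e₀ | b (suc zero) in e₁ | b (suc (suc zero)) in e₂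
... | false | true | true = zero , λ { zero → e₀ ; (suc zero) → e₁ ; (suc (suc zero)) → e₂ }
... | true | false | true = suc zero , λ { zero → e₀ ; (suc zero) → e₁ ; (suc (suc zero)) → e₂ }
... | true | true | false = suc (suc zero) , λ { zero → e₀ ; (suc zero) → e₁ ; (suc (suc zero)) → e₂ }
... | true | true | true = ⊥-elim (n>0⇒n≢0 1≤d (+-cancelˡ-≡ (d + d) d 0 (trans (sym (three-d d)) (trans h (sym (+-identityʳ _))))))
  where
  three-d : ∀ d → d + (d + (d + 0)) ≡ (d + d) + d
  three-d = solve-∀
... | true | false | false = ⊥-elim (n>0⇒n≢0 1≤d (sym (+-cancelˡ-≡ d 0 d h)))
... | false | true | false = ⊥-elim (n>0⇒n≢0 1≤d (sym (+-cancelˡ-≡ d 0 d h)))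
... | false | false | true = ⊥-elim (n>0⇒n≢0 1≤d (sym (+-cancelˡ-≡ d 0 d h)))
... | false | false | false = ⊥-elim (n>0⇒n≢0 1≤d (m+n≡0⇒m≡0 d (sym h)))

injective⇒surjective : ∀ {n} {f : Fin n → Fin n} → Injective _≡_ _≡_ f → Surjective _≡_ _≡_ f
injective⇒surjective {suc n} {f} f-injective y with any? (λ x → f x ≟ y)
... | yes (x , fx≡y) = x , λ { refl → fx≡y }
... | no missed = ⊥-elim (1+n≰n (injective⇒≤ {f = squeeze} squeeze-injective))
  where
  squeeze : Fin (suc n) → Fin n
  squeeze x = punchOut {i = y} {j = f x} (λ eq → missed (x , sym eq))
  squeeze-injective : Injective _≡_ _≡_ squeeze
  squeeze-injective {x} {x′} eq = f-injective (punchOut-injective {i = y} (λ e → missed (x , sym e)) (λ e → missed (x′ , sym e)) eq)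

module DecompositionToPalettes (G : Graph) (k : ℕ) (reg : Regular G k) (class2 : Class2 G)
  (t : ℕ) (F : Fin t → Subgraph G) (dec : Decomposition G t F)
  (s : Fin t → ℕ) (regular : ∀ i → Regular (H (F i)) (s i)) (class1 : ∀ i → Class1 (H (F i))) where

  open GluedColouring G t F dec s regular class1 public
  open RegularColouring G k reg glued glued-proper using (_≈ₚ_; ≈ₚ⇒SamePalette; SamePalette⇒≈ₚ; three-distinct-palettes)

  -- The palette of a vertex is determined by the unique part ι j missing it.
  module MissingPart (d : ℕ) (1≤d : 1 ≤ d) (ι : Fin 3 → Fin t) (s-ι : ∀ j → s (ι j) ≡ d)
    (ι-or-spanning : ∀ i → (Σ (Fin 3) λ j → ι j ≡ i) ⊎ (∀ v → inPart? i v ≡ true))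
    (in-two-parts : ∀ v → sumFin 3 (λ j → if inPart? (ι j) v then d else 0) ≡ d + d) where

    missing : Fin (n G) → Fin 3
    missing v = proj₁ (exactly-one-false d 1≤d (λ j → inPart? (ι j) v) (in-two-parts v))

    inPart?-missing : ∀ v j → inPart? (ι j) v ≡ not (eqᶠ j (missing v))
    inPart?-missing v = proj₂ (exactly-one-false d 1≤d (λ j → inPart? (ι j) v) (in-two-parts v))

    same-missing⇒≈ₚ : ∀ v w → missing v ≡ missing w → v ≈ₚ w
    same-missing⇒≈ₚ v w eq x = begin
      inPalette? glued v x                                ≡⟨ palette-glued v x ⟩
      anyFin t (λ i → inPart? i v ∧ inInterval? i x)      ≡⟨ anyFin-cong t (λ i → cong (_∧ inInterval? i x) (same-parts i)) ⟩
      anyFin t (λ i → inPart? i w ∧ inInterval? i x)      ≡⟨ sym (palette-glued w x) ⟩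
      inPalette? glued w x                                ∎
      where
      open ≡-Reasoning
      open Palette G using (inPalette?)
      same-parts : ∀ i → inPart? i v ≡ inPart? i w
      same-parts i with ι-or-spanning i
      ... | inj₂ spanning = trans (spanning v) (sym (spanning w))
      ... | inj₁ (j , refl) = trans (inPart?-missing v j) (trans (cong (λ z → not (eqᶠ j z)) eq) (sym (inPart?-missing w j)))

    -- The first colour of the part missed by v is seen at w.
    ≈ₚ⇒same-missing : ∀ v w → v ≈ₚ w → missing v ≡ missing w
    ≈ₚ⇒same-missing v w v≈w with missing v ≟ missing w
    ... | yes eq = eq
    ... | no ne = ⊥-elim (true≢false (begin
      true              ≡⟨ sym (∧-projˡ {inPart? i v} (subst (λ z → (inPart? z v ∧ inInterval? z x₀) ≡ true) i′≡i (proj₂ found))) ⟩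
      inPart? i v       ≡⟨ inPart?-missing v j ⟩
      not (eqᶠ j j)     ≡⟨ cong not (eqᶠ-refl j) ⟩
      false             ∎))
      where
      open ≡-Reasoning
      open Palette G using (inPalette?)
      j : Fin 3
      j = missing v
      i : Fin t
      i = ι j
      x₀ : ℕ
      x₀ = offset i + 0
      x₀∈i : inInterval? i x₀ ≡ true
      x₀∈i = inInterval-+ (offset i) (s i) 0 (subst (0 <_) (sym (s-ι j)) 1≤d)
      w∈i : inPart? i w ≡ true
      w∈i = trans (inPart?-missing w j) (cong not (≢true⇒≡false (ne ∘ eqᶠ-true⇒≡)))
      x₀∈v : inPalette? glued v x₀ ≡ true
      x₀∈v = trans (v≈w x₀) (trans (palette-glued w x₀) (anyFin-complete t _ i (∧-intro w∈i x₀∈i)))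
      found : ∃ λ i′ → (inPart? i′ v ∧ inInterval? i′ x₀) ≡ true
      found = anyFin-sound t _ (trans (sym (palette-glued v x₀)) x₀∈v)
      i′≡i : proj₁ found ≡ i
      i′≡i = intervals-disjoint _ i x₀ (∧-projʳ {inPart? (proj₁ found) v} (proj₂ found)) x₀∈i

    missing-onto : Surjective _≡_ _≡_ missing
    missing-onto y with three-distinct-palettes class2
    ... | vertex , distinct with injective⇒surjective {f = missing ∘ vertex}
                                  (λ {i} {j} eq → distinct i j (same-missing⇒≈ₚ (vertex i) (vertex j) eq)) y
    ... | i , hit = vertex i , λ { refl → hit refl }

    palette-index : PaletteIndex G 3
    palette-index = (glued , glued-proper , three-palettes) , class2⇒3≤palettes G k reg class2
      where
      three-palettes : NumPalettes G glued 3
      three-palettes = missing , missing-onto , λ v w →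
        (λ eq → ≈ₚ⇒SamePalette v w (same-missing⇒≈ₚ v w eq)) , (λ same → ≈ₚ⇒same-missing v w (SamePalette⇒≈ₚ v w same))

sumFin-last : ∀ n (f : Fin (suc n) → ℕ) → sumFin (suc n) f ≡ sumFin n (f ∘ inject₁) + f (fromℕ n)
sumFin-last zero f = +-identityʳ (f zero)
sumFin-last (suc n) f = trans (cong (f zero +_) (sumFin-last n (f ∘ suc))) (sym (+-assoc (f zero) _ _))

2*d≡d+d : ∀ d → 2 * d ≡ d + d
2*d≡d+d d = cong (d +_) (+-identityʳ d)

paletteIndex3⇒class2∧decomposition : ∀ G k → Regular G k → PaletteIndex G 3
  → Class2 G × Σ ℕ (λ r → r < k × DecompCondition G k r)
paletteIndex3⇒class2∧decomposition G k reg ((c , proper , f , f-onto , f-classes) , minimal) =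
  class2 , PalettesToDecomposition.three-palettes⇒decomposition G k reg c proper f f-onto f-classes class2
  where
  class2 : Class2 G
  class2 class1 with class1⇒onePalette G k reg (proj₁ (f-onto zero)) class1
  ... | c₁ , proper₁ , one-palette with s≤s () ← minimal c₁ proper₁ 1 one-palette

three-parts⇒paletteIndex3 : ∀ G k → Regular G k → Class2 G → ∀ d → 1 ≤ d → 2 * d + 0 ≡ k
  → (F : Fin 3 → Subgraph G) → Decomposition G 3 F → (∀ i → Regular (H (F i)) d × Class1 (H (F i)))
  → PaletteIndex G 3
three-parts⇒paletteIndex3 G k reg class2 d 1≤d 2d≡k F dec parts = palette-index
  where
  open DecompositionToPalettes G k reg class2 3 F dec (λ _ → d) (proj₁ ∘ parts) (proj₂ ∘ parts)
  in-two-parts : ∀ v → sumFin 3 (λ j → if inPart? j v then d else 0) ≡ d + d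
  in-two-parts v = trans (degree-by-parts k reg v) (trans (sym 2d≡k) (trans (+-identityʳ _) (2*d≡d+d d)))
  open MissingPart d 1≤d (λ i → i) (λ _ → refl) (λ i → inj₁ (i , refl)) in-two-parts

four-parts⇒paletteIndex3 : ∀ G k → Regular G k → Class2 G → ∀ d r → 1 ≤ d → 2 * d + r ≡ k
  → (F : Fin 4 → Subgraph G) → Decomposition G 4 F
  → (∀ (i : Fin 3) → Regular (H (F (inject₁ i))) d × Class1 (H (F (inject₁ i))))
  → Spanning (F (fromℕ 3)) → Regular (H (F (fromℕ 3))) r → Class1 (H (F (fromℕ 3)))
  → PaletteIndex G 3
four-parts⇒paletteIndex3 G k reg class2 d r 1≤d 2d+r≡k F dec parts spanning regular-last class1-last = palette-index
  where
  s : Fin 4 → ℕ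
  s zero = d
  s (suc zero) = d
  s (suc (suc zero)) = d
  s (suc (suc (suc zero))) = r
  regular : ∀ i → Regular (H (F i)) (s i)
  regular zero = proj₁ (parts zero)
  regular (suc zero) = proj₁ (parts (suc zero))
  regular (suc (suc zero)) = proj₁ (parts (suc (suc zero)))
  regular (suc (suc (suc zero))) = regular-last
  class1 : ∀ i → Class1 (H (F i))
  class1 zero = proj₂ (parts zero)
  class1 (suc zero) = proj₂ (parts (suc zero))
  class1 (suc (suc zero)) = proj₂ (parts (suc (suc zero)))
  class1 (suc (suc (suc zero))) = class1-last
  open DecompositionToPalettes G k reg class2 4 F dec s regular class1
  in-last : ∀ v → inPart? (fromℕ 3) v ≡ true
  in-last v = inPart?-intro (fromℕ 3) (proj₁ (spanning v)) v (proj₂ (spanning v) refl)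
  s-inject₁ : ∀ j → s (inject₁ j) ≡ d
  s-inject₁ zero = refl
  s-inject₁ (suc zero) = refl
  s-inject₁ (suc (suc zero)) = refl
  inject₁-or-spanning : ∀ i → (Σ (Fin 3) λ j → inject₁ j ≡ i) ⊎ (∀ v → inPart? i v ≡ true)
  inject₁-or-spanning zero = inj₁ (zero , refl)
  inject₁-or-spanning (suc zero) = inj₁ (suc zero , refl)
  inject₁-or-spanning (suc (suc zero)) = inj₁ (suc (suc zero) , refl)
  inject₁-or-spanning (suc (suc (suc zero))) = inj₂ in-last
  in-two-parts : ∀ v → sumFin 3 (λ j → if inPart? (inject₁ j) v then d else 0) ≡ d + d
  in-two-parts v = trans (+-cancelʳ-≡ r _ _ (begin
    sumFin 3 (λ j → if inPart? (inject₁ j) v then d else 0) + r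
      ≡⟨ cong₂ _+_ (sumFin-cong 3 (λ j → cong (λ x → if inPart? (inject₁ j) v then x else 0) (sym (s-inject₁ j))))
                   (cong (λ b → if b then r else 0) (sym (in-last v))) ⟩
    sumFin 3 (part-degree ∘ inject₁) + part-degree (fromℕ 3)  ≡⟨ sym (sumFin-last 3 part-degree) ⟩
    sumFin 4 part-degree                                      ≡⟨ degree-by-parts k reg v ⟩
    k                                                         ≡⟨ sym 2d+r≡k ⟩
    2 * d + r                                                 ∎)) (2*d≡d+d d)
    where
    open ≡-Reasoning
    part-degree : Fin 4 → ℕ
    part-degree i = if inPart? i v then s i else 0
  open MissingPart d 1≤d inject₁ s-inject₁ inject₁-or-spanning in-two-parts

corollary8 : (G : Graph) (k : ℕ) → Regular G k
    → (PaletteIndex G 3 → Class2 G × Σ ℕ (λ r → r < k × DecompCondition G k r))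
    × (Class2 G × Σ ℕ (λ r → r < k × DecompCondition G k r) → PaletteIndex G 3)
corollary8 G k reg = paletteIndex3⇒class2∧decomposition G k reg , decomposition⇒paletteIndex3
  where
  1≤d : ∀ {d r} → r < k → 2 * d + r ≡ k → 1 ≤ d
  1≤d {zero} r<k r≡k = ⊥-elim (<⇒≢ r<k r≡k)
  1≤d {suc d} _ _ = s≤s z≤n
  decomposition⇒paletteIndex3 : Class2 G × Σ ℕ (λ r → r < k × DecompCondition G k r) → PaletteIndex G 3
  decomposition⇒paletteIndex3 (class2 , r , r<k , d , 2d+r≡k , inj₁ (refl , F , dec , parts)) =
    three-parts⇒paletteIndex3 G k reg class2 d (1≤d r<k 2d+r≡k) 2d+r≡k F dec parts
  decomposition⇒paletteIndex3 (class2 , r , r<k , d , 2d+r≡k , inj₂ (_ , F , dec , parts , spanning , regular , class1)) =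
    four-parts⇒paletteIndex3 G k reg class2 d r (1≤d r<k 2d+r≡k) 2d+r≡k F dec parts spanning regular class1
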